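{- Let $G$ be a finite abelian group of order $n$ and let $i$ be an integer with $0 \leq i \leq n$. For $g \in G$ let $N(i,g)=\#\{S \subseteq G: \#S=i,\ \sum_{s \in S}s=g\}$. Then for every $g \in G$, \[ N(i,g)=\frac{1}{n} \sum_{s \mid \gcd(\exp(G),i)} (-1)^{i+\frac{i}{s}} \binom{n/s}{i/s} \sum_{d \mid \gcd(e(g),s)} \mu\!\left(\frac{s}{d}\right) \#G[d], \] where the sums run over positive divisors.
   Context: $\exp(G)$ denotes the exponent of $G$. For $g \in G$, $e(g)=\max\{d : d \mid \exp(G),\ g \in dG\}$, where $dG=\{dh : h \in G\}$ and $d$ ranges over positive integers. For a positive integer $d$, $G[d]=\{h \in G : dh=0\}$ is the $d$-torsion subgroup of $G$. $\mu$ is the Möbius function. -}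

module Defs where

open import Level using (0ℓ)
open import Data.Nat as ℕ using (ℕ; zero; suc; _≤_; _<_; _∸_)
open import Data.Nat.Divisibility using (_∣_; _∣?_)
open import Data.Nat.DivMod using (_/_)
open import Data.Nat.Primality using (Prime; prime?)
open import Data.Nat.Combinatorics using (_C_)
open import Data.Integer as ℤ using (ℤ; +_)
open import Data.Fin as Fin using (Fin)
import Data.Fin.Properties as FinP
open import Data.Fin.Subset using (Subset; ∣_∣)
open import Data.Vec using (Vec; []; _∷_; lookup)
open import Data.Bool using (Bool; true; false; if_then_else_)
open import Data.Bool.ListAction using (any)
open import Data.List as List using (List; []; _∷_; _++_; filter; length; upTo)
open import Data.Product using (_×_; ∃; _,_)
open import Relation.Nullary using (Dec; yes; no; ¬_)
open import Relation.Nullary.Decidable using (_×-dec_; ⌊_⌋)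
open import Relation.Binary.PropositionalEquality using (_≡_; refl; cong; sym; trans)
open import Algebra.Structures using (IsAbelianGroup)
open import Function.Bundles using (_↔_; Inverse)

record FiniteAbelianGroup : Set₁ where
  infixl 6 _+_
  field
    Carrier        : Set
    _+_            : Carrier → Carrier → Carrier
    0#             : Carrier
    -_             : Carrier → Carrier
    isAbelianGroup : IsAbelianGroup _≡_ _+_ 0# -_
    order          : ℕ
    enum           : Fin order ↔ Carrier

  _≟_ : (x y : Carrier) → Dec (x ≡ y)
  x ≟ y with Inverse.from enum x FinP.≟ Inverse.from enum y
  ... | yes p = yes (trans (sym (Inverse.strictlyInverseˡ enum x))
                      (trans (cong (Inverse.to enum) p) (Inverse.strictlyInverseˡ enum y)))
  ... | no ¬p = no λ x≡y → ¬p (cong (Inverse.from enum) x≡y)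

  _·_ : ℕ → Carrier → Carrier
  zero  · h = 0#
  suc d · h = h + (d · h)

  gsum : {m : ℕ} → (Fin m → Carrier) → Carrier
  gsum {zero}  f = 0#
  gsum {suc m} f = f Fin.zero + gsum (λ j → f (Fin.suc j))

  subsetSum : Subset order → Carrier
  subsetSum p = gsum (λ j → if lookup p j then Inverse.to enum j else 0#)

  elements : List Carrier
  elements = List.map (Inverse.to enum) (List.allFin order)

  torsionCount : ℕ → ℕ
  torsionCount d = length (filter (λ h → (d · h) ≟ 0#) elements)

allSubsets : (n : ℕ) → List (Subset n)
allSubsets zero    = [] ∷ []
allSubsets (suc n) = List.map (true ∷_) (allSubsets n) ++ List.map (false ∷_) (allSubsets n)

module _ (G : FiniteAbelianGroup) where
  open FiniteAbelianGroup G

  N : ℕ → Carrier → ℕ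
  N i g = length (filter (λ p → (∣ p ∣ ℕ.≟ i) ×-dec (subsetSum p ≟ g)) (allSubsets order))

  IsExponent : ℕ → Set
  IsExponent m = (0 < m) × (∀ h → m · h ≡ 0#)
               × (∀ k → 0 < k → (∀ h → k · h ≡ 0#) → m ≤ k)

  _∈_G : Carrier → ℕ → Set
  g ∈ d G = ∃ λ h → d · h ≡ g

  IsE : ℕ → Carrier → ℕ → Set
  IsE ex g e = (e ∣ ex) × (g ∈ e G) × (∀ d → d ∣ ex → g ∈ d G → d ≤ e)

-- exact division as used for divisors (a div 0 := 0, never used on 0)
_div_ : ℕ → ℕ → ℕ
a div zero  = 0
a div suc k = a / suc k

divisors : ℕ → List ℕ
divisors m = filter (λ d → d ∣? m) (List.map suc (upTo m))

sumDiv : ℕ → (ℕ → ℤ) → ℤ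
sumDiv m f = List.foldr ℤ._+_ (+ 0) (List.map f (divisors m))

primeDivisors : ℕ → List ℕ
primeDivisors m = filter (λ p → prime? p ×-dec (p ∣? m)) (upTo (suc m))

hasSquarePrimeFactor : ℕ → Bool
hasSquarePrimeFactor m = any (λ p → ⌊ (p ℕ.* p) ∣? m ⌋) (primeDivisors m)

μ : ℕ → ℤ
μ m = if hasSquarePrimeFactor m then + 0 else (ℤ.-1ℤ ℤ.^ length (primeDivisors m))

module Submission where

-- Write X_l(g) = n N(l, g). Adjoining the elements of G one at a time gives Newton's identity
-- (l + 1) X_{l+1}(g) = Σ_{k ≤ l} (-1)^k Σ_h X_{l-k}(g - (k + 1) h), which determines X from X_0.
-- The functions ρ_s(g) = Σ_{d ∣ s} μ(s/d) #{h : d h = g} are eigenfunctions of the shifts: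
-- Σ_h ρ_s(g - k h) = n [s ∣ k] ρ_s(g), since #{(h, h′) : k h + d h′ = g} = n #{h : gcd(k, d) h = g}
-- (run Euclid's algorithm on (k, d)) and by Möbius inversion. An alternating binomial identity then
-- shows that Y_l = Σ_{s ∣ exp G} [s ∣ l] (-1)^(l + l/s) C(n/s, l/s) ρ_s satisfies the same recursion,
-- and Y_0 = X_0, so X = Y. Finally #{h : d h = g} = [d ∣ e(g)] #G[d] for d ∣ exp G (an lcm argument),
-- which turns ρ_s(g) into the inner sum of the formula.

import Defs

module RangeSum where

  open import Data.Nat as ℕ using (ℕ; zero; suc; _≤_; _<_; z≤n; s≤s; _∸_)
  import Data.Nat.Properties as ℕP
  open import Data.Integer as ℤ using (ℤ; +_; _+_; _*_; -_)
  import Data.Integer.Properties as ℤP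
  open import Data.Fin using (Fin; toℕ; fromℕ<)
  import Data.Fin.Properties as FinP
  open import Data.Fin.Permutation using (Permutation; permutation)
  open import Data.Bool using (Bool; true; false; _∧_)
  open import Function using (_∘_; mk⇔)
  open import Relation.Binary.PropositionalEquality
  open import Relation.Nullary using (Dec; yes; no; does; ¬_; contradiction)
  open import Relation.Nullary.Decidable using (does-⇔; ¬?)
  open import Algebra.Properties.Semiring.Sum ℤP.+-*-semiring
    using (sum; ∑-distrib-+; ∑-comm; *-distribˡ-sum; *-distribʳ-sum; sum-replicate-zero; sum-permute; sum-cong-≗)

  ∑< : ℕ → (ℕ → ℤ) → ℤ
  ∑< m f = sum {m} (f ∘ toℕ)

  ∑<-cong-< : ∀ m {f g : ℕ → ℤ} → (∀ t → t < m → f t ≡ g t) → ∑< m f ≡ ∑< m g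
  ∑<-cong-< zero    eq = refl
  ∑<-cong-< (suc m) eq = cong₂ _+_ (eq 0 (s≤s z≤n)) (∑<-cong-< m (λ t t<m → eq (suc t) (s≤s t<m)))

  ∑<-cong : ∀ m {f g : ℕ → ℤ} → (∀ t → f t ≡ g t) → ∑< m f ≡ ∑< m g
  ∑<-cong m eq = ∑<-cong-< m (λ t _ → eq t)

  ∑<-distrib-+ : ∀ m (f g : ℕ → ℤ) → ∑< m (λ t → f t + g t) ≡ ∑< m f + ∑< m g
  ∑<-distrib-+ m f g = ∑-distrib-+ {m} (f ∘ toℕ) (g ∘ toℕ)

  *-distribˡ-∑< : ∀ m c (f : ℕ → ℤ) → c * ∑< m f ≡ ∑< m (λ t → c * f t)
  *-distribˡ-∑< m c f = *-distribˡ-sum {m} c (f ∘ toℕ)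

  *-distribʳ-∑< : ∀ m c (f : ℕ → ℤ) → ∑< m f * c ≡ ∑< m (λ t → f t * c)
  *-distribʳ-∑< m c f = *-distribʳ-sum {m} c (f ∘ toℕ)

  neg-distrib-∑< : ∀ m (f : ℕ → ℤ) → - ∑< m f ≡ ∑< m (λ t → - f t)
  neg-distrib-∑< m f = begin
    - ∑< m f                     ≡⟨ ℤP.-1*i≡-i _ ⟨
    - + 1 * ∑< m f               ≡⟨ *-distribˡ-∑< m (- + 1) f ⟩
    ∑< m (λ t → - + 1 * f t)     ≡⟨ ∑<-cong m (λ t → ℤP.-1*i≡-i (f t)) ⟩
    ∑< m (λ t → - f t)           ∎
    where open ≡-Reasoning

  ∑<-comm : ∀ a b (f : ℕ → ℕ → ℤ) → ∑< a (λ s → ∑< b (f s)) ≡ ∑< b (λ t → ∑< a (λ s → f s t))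
  ∑<-comm a b f = ∑-comm {a} {b} (λ i j → f (toℕ i) (toℕ j))

  ∑<-const : ∀ m c → ∑< m (λ _ → c) ≡ + m * c
  ∑<-const zero    c = sym (ℤP.*-zeroˡ c)
  ∑<-const (suc m) c = begin
    c + ∑< m (λ _ → c)   ≡⟨ cong (_+_ c) (∑<-const m c) ⟩
    c + + m * c          ≡⟨ cong (_+ + m * c) (ℤP.*-identityˡ c) ⟨
    + 1 * c + + m * c    ≡⟨ ℤP.*-distribʳ-+ c (+ 1) (+ m) ⟨
    + suc m * c          ∎
    where open ≡-Reasoning

  ∑<-zero : ∀ m (f : ℕ → ℤ) → (∀ t → t < m → f t ≡ + 0) → ∑< m f ≡ + 0
  ∑<-zero m f eq = trans (∑<-cong-< m eq) (sum-replicate-zero m)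

  ∑<-+ : ∀ a b (f : ℕ → ℤ) → ∑< (a ℕ.+ b) f ≡ ∑< a f + ∑< b (λ t → f (a ℕ.+ t))
  ∑<-+ zero    b f = sym (ℤP.+-identityˡ _)
  ∑<-+ (suc a) b f = trans (cong (_+_ (f 0)) (∑<-+ a b (f ∘ suc))) (sym (ℤP.+-assoc (f 0) _ _))

  ∑<-suc : ∀ m (f : ℕ → ℤ) → ∑< (suc m) f ≡ ∑< m f + f m
  ∑<-suc m f = begin
    ∑< (suc m) f                ≡⟨ cong (λ k → ∑< k f) (ℕP.+-comm 1 m) ⟩
    ∑< (m ℕ.+ 1) f              ≡⟨ ∑<-+ m 1 f ⟩
    ∑< m f + (f (m ℕ.+ 0) + + 0) ≡⟨ cong (λ x → ∑< m f + x) (trans (ℤP.+-identityʳ _) (cong f (ℕP.+-identityʳ m))) ⟩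
    ∑< m f + f m                ∎
    where open ≡-Reasoning

  ∑<-telescope : ∀ m (f r : ℕ → ℤ) → (∀ k → k < m → r k ≡ - f (suc k)) → r m ≡ + 0 →
    ∑< (suc m) (λ k → f k + r k) ≡ f 0
  ∑<-telescope m f r r≡-f r[m]≡0 = begin
    ∑< (suc m) (λ k → f k + r k)                      ≡⟨ ∑<-distrib-+ (suc m) f r ⟩
    ∑< (suc m) f + ∑< (suc m) r                       ≡⟨ cong (_+_ (∑< (suc m) f)) (∑<-suc m r) ⟩
    f 0 + ∑< m (f ∘ suc) + (∑< m r + r m)             ≡⟨ cong (λ x → f 0 + ∑< m (f ∘ suc) + (∑< m r + x)) r[m]≡0 ⟩
    f 0 + ∑< m (f ∘ suc) + (∑< m r + + 0)             ≡⟨ cong (_+_ (f 0 + ∑< m (f ∘ suc))) (ℤP.+-identityʳ _) ⟩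
    f 0 + ∑< m (f ∘ suc) + ∑< m r                     ≡⟨ cong (_+_ (f 0 + ∑< m (f ∘ suc)))
                                                           (trans (∑<-cong-< m r≡-f) (sym (neg-distrib-∑< m (f ∘ suc)))) ⟩
    f 0 + ∑< m (f ∘ suc) + - ∑< m (f ∘ suc)           ≡⟨ ℤP.+-assoc (f 0) _ _ ⟩
    f 0 + (∑< m (f ∘ suc) + - ∑< m (f ∘ suc))         ≡⟨ cong (_+_ (f 0)) (ℤP.+-inverseʳ (∑< m (f ∘ suc))) ⟩
    f 0 + + 0                                         ≡⟨ ℤP.+-identityʳ (f 0) ⟩
    f 0                                               ∎
    where open ≡-Reasoning

  ∑<-extend : ∀ a b (f : ℕ → ℤ) → a ≤ b → (∀ t → a ≤ t → t < b → f t ≡ + 0) → ∑< b f ≡ ∑< a f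
  ∑<-extend a b f a≤b vanish = begin
    ∑< b f                                  ≡⟨ cong (λ k → ∑< k f) (ℕP.m+[n∸m]≡n a≤b) ⟨
    ∑< (a ℕ.+ (b ∸ a)) f                    ≡⟨ ∑<-+ a (b ∸ a) f ⟩
    ∑< a f + ∑< (b ∸ a) (λ t → f (a ℕ.+ t)) ≡⟨ cong (_+_ (∑< a f)) (∑<-zero (b ∸ a) _ tail) ⟩
    ∑< a f + + 0                            ≡⟨ ℤP.+-identityʳ _ ⟩
    ∑< a f                                  ∎
    where
    open ≡-Reasoning
    tail : ∀ t → t < b ∸ a → f (a ℕ.+ t) ≡ + 0
    tail t t<b∸a = vanish (a ℕ.+ t) (ℕP.m≤m+n a t)
      (subst (a ℕ.+ t <_) (ℕP.m+[n∸m]≡n a≤b) (ℕP.+-monoʳ-< a t<b∸a))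

  ∑<-reverse : ∀ m (f : ℕ → ℤ) → ∑< m f ≡ ∑< m (λ t → f (m ∸ suc t))
  ∑<-reverse zero    f = refl
  ∑<-reverse (suc m) f = begin
    ∑< (suc m) f                     ≡⟨ ∑<-suc m f ⟩
    ∑< m f + f m                     ≡⟨ cong (_+ f m) (∑<-reverse m f) ⟩
    ∑< m (λ t → f (m ∸ suc t)) + f m ≡⟨ ℤP.+-comm _ (f m) ⟩
    ∑< (suc m) (λ t → f (suc m ∸ suc t)) ∎
    where open ≡-Reasoning

  ∑<-single : ∀ m k (f : ℕ → ℤ) → k < m → (∀ t → t < m → t ≢ k → f t ≡ + 0) → ∑< m f ≡ f k
  ∑<-single (suc m) zero f _ others =
    trans (cong (_+_ (f 0)) (∑<-zero m _ (λ t t<m → others (suc t) (s≤s t<m) (λ ()))))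
          (ℤP.+-identityʳ _)
  ∑<-single (suc m) (suc k) f (s≤s k<m) others =
    trans (cong (_+ ∑< m (f ∘ suc)) (others 0 (s≤s z≤n) (λ ())))
     (trans (ℤP.+-identityˡ _)
       (∑<-single m k (f ∘ suc) k<m (λ t t<m t≢k → others (suc t) (s≤s t<m) (t≢k ∘ ℕP.suc-injective))))

  ∑<-involution : ∀ m (φ : ℕ → ℕ) → (∀ t → t < m → φ t < m) → (∀ t → t < m → φ (φ t) ≡ t) →
    ∀ (f : ℕ → ℤ) → ∑< m (f ∘ φ) ≡ ∑< m f
  ∑<-involution m φ φ<m φφ f = sym (begin
    sum {m} (f ∘ toℕ)               ≡⟨ sum-permute {m} (f ∘ toℕ) π ⟩
    sum {m} (f ∘ toℕ ∘ φᶠ)          ≡⟨ sum-cong-≗ {m} (λ j → cong f (FinP.toℕ-fromℕ< _)) ⟩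
    sum {m} (f ∘ φ ∘ toℕ)           ∎)
    where
    open ≡-Reasoning
    φᶠ : Fin m → Fin m
    φᶠ j = fromℕ< (φ<m (toℕ j) (FinP.toℕ<n j))
    φᶠ-involutive : ∀ j → φᶠ (φᶠ j) ≡ j
    φᶠ-involutive j = FinP.toℕ-injective (trans (FinP.toℕ-fromℕ< _)
      (trans (cong φ (FinP.toℕ-fromℕ< _)) (φφ (toℕ j) (FinP.toℕ<n j))))
    π : Permutation m m
    π = permutation φᶠ φᶠ φᶠ-involutive φᶠ-involutive

  when : Bool → ℤ → ℤ
  when true  x = x
  when false x = + 0

  𝟙 : ∀ {p} {P : Set p} → Dec P → ℤ
  𝟙 P? = when (does P?) (+ 1)

  when-does-cong : ∀ {p} {P : Set p} (P? : Dec P) {x y} → (P → x ≡ y) → when (does P?) x ≡ when (does P?) y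
  when-does-cong (yes p) eq = eq p
  when-does-cong (no _)  eq = refl

  when-yes : ∀ {p} {P : Set p} (P? : Dec P) x → P → when (does P?) x ≡ x
  when-yes (yes _)  x _ = refl
  when-yes (no ¬p) x p = contradiction p ¬p

  when-no : ∀ {p} {P : Set p} (P? : Dec P) x → ¬ P → when (does P?) x ≡ + 0
  when-no (yes p) x ¬p = contradiction p ¬p
  when-no (no _)  x _  = refl

  when-does-intro : ∀ {p} {P : Set p} (P? : Dec P) x → (¬ P → x ≡ + 0) → x ≡ when (does P?) x
  when-does-intro (yes _) x vanish = refl
  when-does-intro (no ¬p) x vanish = vanish ¬p

  when-does-⇔ : ∀ {p q} {P : Set p} {Q : Set q} (P? : Dec P) (Q? : Dec Q) x →
    (P → Q) → (Q → P) → when (does P?) x ≡ when (does Q?) x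
  when-does-⇔ P? Q? x to from = cong (λ b → when b x) (does-⇔ (mk⇔ to from) P? Q?)

  when-zero : ∀ b → when b (+ 0) ≡ + 0
  when-zero true  = refl
  when-zero false = refl

  when-∧ : ∀ b c x → when b (when c x) ≡ when (b ∧ c) x
  when-∧ true  c x = refl
  when-∧ false c x = refl

  when-comm : ∀ b c x → when b (when c x) ≡ when c (when b x)
  when-comm true  true  x = refl
  when-comm true  false x = refl
  when-comm false c     x = sym (when-zero c)

  when-*ˡ : ∀ b x y → when b x * y ≡ when b (x * y)
  when-*ˡ true  x y = refl
  when-*ˡ false x y = refl

  when-*ʳ : ∀ b x y → x * when b y ≡ when b (x * y)
  when-*ʳ true  x y = refl
  when-*ʳ false x y = ℤP.*-zeroʳ x

  when-neg : ∀ b x → when b (- x) ≡ - when b x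
  when-neg true  x = refl
  when-neg false x = refl

  when-+ : ∀ b x y → when b (x + y) ≡ when b x + when b y
  when-+ true  x y = refl
  when-+ false x y = refl

  when-¬?+when : ∀ {p} {P : Set p} (P? : Dec P) x → when (does (¬? P?)) x + when (does P?) x ≡ x
  when-¬?+when (yes _) x = ℤP.+-identityˡ x
  when-¬?+when (no _)  x = ℤP.+-identityʳ x

  when-∑< : ∀ b m (f : ℕ → ℤ) → when b (∑< m f) ≡ ∑< m (λ t → when b (f t))
  when-∑< true  m f = refl
  when-∑< false m f = sym (sum-replicate-zero m)


module DivisorSum where

  open import Data.Nat as ℕ using (ℕ; zero; suc; _≤_; _<_; s≤s; _∸_; NonZero)
  import Data.Nat.Properties as ℕP
  open import Data.Nat.Divisibility
  open import Data.Nat.DivMod using (_/_; m/n*n≡m; m*[n/m]≡n; m≥n⇒m/n>0; m*n/n≡m; m*n/m*o≡n/o)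
  open import Data.Nat.GCD using (gcd; gcd[m,n]∣m; gcd[m,n]∣n; gcd-greatest; gcd[m,n]≢0; gcd[m,n]≤n)
  open import Data.Integer as ℤ using (ℤ; +_; _+_; -_)
  import Data.Integer.Properties as ℤP
  open import Data.Bool using (Bool; true; false)
  open import Data.List as List using (applyUpTo; filter)
  import Data.List.Properties as ListP
  open import Data.Product using (_,_)
  open import Data.Sum using (inj₂)
  open import Function using (_∘_; id)
  open import Relation.Binary.PropositionalEquality
  open import Relation.Nullary using (Dec; yes; no; does; ¬_; contradiction)
  open import Relation.Nullary.Decidable using (_×-dec_)
  open import Defs using (sumDiv; _div_)
  open RangeSum

  infix 4 _∣ᵇ_
  _∣ᵇ_ : ℕ → ℕ → Bool
  d ∣ᵇ m = does (d ∣? m)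

  ∑∣ : ℕ → (ℕ → ℤ) → ℤ
  ∑∣ m f = ∑< m (λ t → when (suc t ∣ᵇ m) (f (suc t)))

  ∑-filter : ∀ {p} {P : ℕ → Set p} (P? : ∀ x → Dec (P x)) (f : ℕ → ℤ) (h : ℕ → ℕ) k →
    List.foldr _+_ (+ 0) (List.map f (filter P? (applyUpTo h k)))
      ≡ ∑< k (λ t → when (does (P? (h t))) (f (h t)))
  ∑-filter P? f h zero = refl
  ∑-filter P? f h (suc k) with does (P? (h 0))
  ... | true  = cong (_+_ (f (h 0))) (∑-filter P? f (h ∘ suc) k)
  ... | false = trans (∑-filter P? f (h ∘ suc) k) (sym (ℤP.+-identityˡ _))

  sumDiv≡∑∣ : ∀ m (f : ℕ → ℤ) → sumDiv m f ≡ ∑∣ m f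
  sumDiv≡∑∣ m f =
    trans (cong (λ ds → List.foldr _+_ (+ 0) (List.map f (filter (_∣? m) ds)))
                (ListP.map-applyUpTo id suc m))
          (∑-filter (_∣? m) f suc m)

  ∣-nonZero : ∀ {d m} .{{_ : NonZero m}} → d ∣ m → NonZero d
  ∣-nonZero {suc _}     _   = _
  ∣-nonZero {zero}  {m} 0∣m = contradiction (0∣⇒≡0 0∣m) (ℕ.≢-nonZero⁻¹ m)

  gcd-nonZeroʳ : ∀ a b .{{_ : NonZero b}} → NonZero (gcd a b)
  gcd-nonZeroʳ a b@(suc _) = ℕ.≢-nonZero (gcd[m,n]≢0 a b (inj₂ (λ ())))

  m*n-div-m≡n : ∀ m n .{{_ : NonZero m}} → (m ℕ.* n) div m ≡ n
  m*n-div-m≡n m@(suc _) n = trans (cong (_/ m) (ℕP.*-comm m n)) (m*n/n≡m n m)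

  m*n-div-m*o≡n-div-o : ∀ m n o .{{_ : NonZero m}} → (m ℕ.* n) div (m ℕ.* o) ≡ n div o
  m*n-div-m*o≡n-div-o m n zero    rewrite ℕP.*-zeroʳ m = refl
  m*n-div-m*o≡n-div-o m@(suc _) n (suc o) = m*n/m*o≡n/o m n (suc o)

  ∑∣-cong : ∀ m {f g : ℕ → ℤ} → (∀ d → d ∣ m → f d ≡ g d) → ∑∣ m f ≡ ∑∣ m g
  ∑∣-cong m eq = ∑<-cong m (λ t → when-does-cong (suc t ∣? m) (eq (suc t)))

  ∑∣-distrib-+ : ∀ m (f g : ℕ → ℤ) → ∑∣ m (λ d → f d + g d) ≡ ∑∣ m f + ∑∣ m g
  ∑∣-distrib-+ m f g = trans (∑<-cong m (λ t → when-+ (suc t ∣ᵇ m) (f (suc t)) (g (suc t))))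
                             (∑<-distrib-+ m (λ t → when (suc t ∣ᵇ m) (f (suc t))) (λ t → when (suc t ∣ᵇ m) (g (suc t))))

  neg-distrib-∑∣ : ∀ m (f : ℕ → ℤ) → - ∑∣ m f ≡ ∑∣ m (λ d → - f d)
  neg-distrib-∑∣ m f = trans (neg-distrib-∑< m (λ t → when (suc t ∣ᵇ m) (f (suc t))))
                             (∑<-cong m (λ t → sym (when-neg (suc t ∣ᵇ m) (f (suc t)))))

  *-distribˡ-∑∣ : ∀ m c (f : ℕ → ℤ) → c ℤ.* ∑∣ m f ≡ ∑∣ m (λ d → c ℤ.* f d)
  *-distribˡ-∑∣ m c f = trans (*-distribˡ-∑< m c (λ t → when (suc t ∣ᵇ m) (f (suc t))))
                              (∑<-cong m (λ t → when-*ʳ (suc t ∣ᵇ m) c (f (suc t))))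

  *-distribʳ-∑∣ : ∀ m c (f : ℕ → ℤ) → ∑∣ m f ℤ.* c ≡ ∑∣ m (λ d → f d ℤ.* c)
  *-distribʳ-∑∣ m c f = trans (*-distribʳ-∑< m c (λ t → when (suc t ∣ᵇ m) (f (suc t))))
                              (∑<-cong m (λ t → when-*ˡ (suc t ∣ᵇ m) (f (suc t)) c))

  ∑<-∑∣-comm : ∀ a M (F : ℕ → ℕ → ℤ) → ∑< a (λ k → ∑∣ M (F k)) ≡ ∑∣ M (λ s → ∑< a (λ k → F k s))
  ∑<-∑∣-comm a M F = trans (∑<-comm a M (λ k t → when (suc t ∣ᵇ M) (F k (suc t))))
                           (∑<-cong M (λ t → sym (when-∑< (suc t ∣ᵇ M) a (λ k → F k (suc t)))))

  ∑∣-extend : ∀ m N (f : ℕ → ℤ) .{{_ : NonZero m}} → m ≤ N →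
    ∑< N (λ t → when (suc t ∣ᵇ m) (f (suc t))) ≡ ∑∣ m f
  ∑∣-extend m N f m≤N = ∑<-extend m N _ m≤N
    (λ t m≤t _ → when-no (suc t ∣? m) (f (suc t)) (λ t+1∣m → ℕP.<⇒≱ (s≤s m≤t) (∣⇒≤ t+1∣m)))

  ∑<-multiples : ∀ d q (f : ℕ → ℤ) →
    ∑< (suc d ℕ.* q) (λ t → when (suc d ∣ᵇ suc t) (f (suc t))) ≡ ∑< q (λ u → f (suc d ℕ.* suc u))
  ∑<-multiples d zero    f = cong (λ k → ∑< k (λ t → when (suc d ∣ᵇ suc t) (f (suc t)))) (ℕP.*-zeroʳ d)
  ∑<-multiples d (suc q) f = begin
    ∑< (D ℕ.* suc q) F                              ≡⟨ cong (λ k → ∑< k F) (ℕP.*-suc D q) ⟩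
    ∑< (D ℕ.+ D ℕ.* q) F                            ≡⟨ ∑<-+ D (D ℕ.* q) F ⟩
    ∑< D F + ∑< (D ℕ.* q) (λ t → F (D ℕ.+ t))       ≡⟨ cong₂ _+_ first rest ⟩
    f D + ∑< q (λ u → f (D ℕ.+ D ℕ.* suc u))        ≡⟨ cong₂ _+_ (cong f (ℕP.*-identityʳ D))
                                                          (∑<-cong q (λ u → cong f (ℕP.*-suc D (suc u)))) ⟨
    ∑< (suc q) (λ u → f (D ℕ.* suc u))              ∎
    where
    open ≡-Reasoning
    D = suc d
    F : ℕ → ℤ
    F t = when (D ∣ᵇ suc t) (f (suc t))
    first : ∑< D F ≡ f D
    first = trans (∑<-single D d F ℕP.≤-refl (λ t t<D t≢d → when-no (D ∣? suc t) (f (suc t))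
                    (λ D∣t+1 → t≢d (ℕP.≤-antisym (ℕP.≤-pred t<D) (ℕP.≤-pred (∣⇒≤ D∣t+1))))))
                  (when-yes (D ∣? D) (f D) ∣-refl)
    rest : ∑< (D ℕ.* q) (λ t → F (D ℕ.+ t)) ≡ ∑< q (λ u → f (D ℕ.+ D ℕ.* suc u))
    rest = trans (∑<-cong (D ℕ.* q) (λ t →
                    trans (cong (λ x → when (D ∣ᵇ x) (f x)) (sym (ℕP.+-suc D t)))
                          (when-does-⇔ (D ∣? D ℕ.+ suc t) (D ∣? suc t) (f (D ℕ.+ suc t)) (∣m+n∣m⇒∣n′ t) (∣m∣n⇒∣m+n ∣-refl))))
                 (∑<-multiples d q (λ x → f (D ℕ.+ x)))
      where
      ∣m+n∣m⇒∣n′ : ∀ t → D ∣ D ℕ.+ suc t → D ∣ suc t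
      ∣m+n∣m⇒∣n′ t p = ∣m+n∣m⇒∣n p ∣-refl

  ∑∣-multiples : ∀ d q (f : ℕ → ℤ) →
    ∑∣ (suc d ℕ.* q) (λ x → when (suc d ∣ᵇ x) (f x)) ≡ ∑∣ q (λ u → f (suc d ℕ.* u))
  ∑∣-multiples d q f = begin
    ∑∣ (suc d ℕ.* q) (λ x → when (suc d ∣ᵇ x) (f x))
      ≡⟨ ∑<-cong (suc d ℕ.* q) (λ t → when-comm (suc t ∣ᵇ suc d ℕ.* q) (suc d ∣ᵇ suc t) (f (suc t))) ⟩
    ∑< (suc d ℕ.* q) (λ t → when (suc d ∣ᵇ suc t) (when (suc t ∣ᵇ suc d ℕ.* q) (f (suc t))))
      ≡⟨ ∑<-multiples d q (λ x → when (x ∣ᵇ suc d ℕ.* q) (f x)) ⟩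
    ∑< q (λ u → when (suc d ℕ.* suc u ∣ᵇ suc d ℕ.* q) (f (suc d ℕ.* suc u)))
      ≡⟨ ∑<-cong q (λ u → when-does-⇔ (suc d ℕ.* suc u ∣? suc d ℕ.* q) (suc u ∣? q) (f (suc d ℕ.* suc u))
                    (*-cancelˡ-∣ (suc d)) (*-monoʳ-∣ (suc d))) ⟩
    ∑∣ q (λ u → f (suc d ℕ.* u)) ∎
    where open ≡-Reasoning

  ∑∣-complement : ∀ m .{{_ : NonZero m}} (f : ℕ → ℤ) → ∑∣ m (λ d → f (m div d)) ≡ ∑∣ m f
  ∑∣-complement m f = trans (∑<-cong m term) (∑<-involution m φ φ<m φφ (λ t → when (suc t ∣ᵇ m) (f (suc t))))
    where
    -- φ t is the index of the complementary divisor m / (t + 1)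
    φ : ℕ → ℕ
    φ t with suc t ∣? m
    ... | yes _ = m / suc t ∸ 1
    ... | no  _ = t

    suc-φ : ∀ t → suc t ∣ m → suc (m / suc t ∸ 1) ≡ m / suc t
    suc-φ t t+1∣m = ℕP.m+[n∸m]≡n (m≥n⇒m/n>0 (∣⇒≤ t+1∣m))

    φ<m : ∀ t → t < m → φ t < m
    φ<m t t<m with suc t ∣? m
    ... | yes t+1∣m = subst (_≤ m) (sym (suc-φ t t+1∣m)) (∣⇒≤ (m/n∣m t+1∣m))
    ... | no  _     = t<m

    φφ : ∀ t → t < m → φ (φ t) ≡ t
    φφ t t<m with suc t ∣? m
    ... | no ¬t+1∣m with suc t ∣? m
    ...   | yes t+1∣m = contradiction t+1∣m ¬t+1∣m
    ...   | no  _     = refl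
    φφ t t<m | yes t+1∣m with suc (m / suc t ∸ 1) ∣? m
    ...   | no ¬c∣m = contradiction (subst (_∣ m) (sym (suc-φ t t+1∣m)) (m/n∣m t+1∣m)) ¬c∣m
    ...   | yes c∣m = cong (_∸ 1) (ℕP.*-cancelʳ-≡ (m / suc (m / suc t ∸ 1)) (suc t) (suc (m / suc t ∸ 1)) (begin
              m / suc (m / suc t ∸ 1) ℕ.* suc (m / suc t ∸ 1) ≡⟨ m/n*n≡m c∣m ⟩
              m                                               ≡⟨ m*[n/m]≡n t+1∣m ⟨
              suc t ℕ.* (m / suc t)                           ≡⟨ cong (suc t ℕ.*_) (suc-φ t t+1∣m) ⟨
              suc t ℕ.* suc (m / suc t ∸ 1)                   ∎))
      where open ≡-Reasoning

    term : ∀ t → when (suc t ∣ᵇ m) (f (m div suc t)) ≡ when (suc (φ t) ∣ᵇ m) (f (suc (φ t)))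
    term t with suc t ∣? m
    ... | yes t+1∣m = trans (when-yes (suc t ∣? m) (f (m div suc t)) t+1∣m)
                            (sym (trans (when-yes (suc (m / suc t ∸ 1) ∣? m) _
                                          (subst (_∣ m) (sym (suc-φ t t+1∣m)) (m/n∣m t+1∣m)))
                                        (cong f (suc-φ t t+1∣m))))
    ... | no ¬t+1∣m = trans (when-no (suc t ∣? m) (f (m div suc t)) ¬t+1∣m)
                            (sym (when-no (suc t ∣? m) (f (suc t)) ¬t+1∣m))

  ∑∣-gcd : ∀ a b .{{_ : NonZero b}} (f : ℕ → ℤ) → ∑∣ (gcd a b) f ≡ ∑∣ b (λ r → when (r ∣ᵇ a) (f r))
  ∑∣-gcd a b f = begin
    ∑∣ (gcd a b) f                                            ≡⟨ ∑∣-extend (gcd a b) b f {{gcd-nonZeroʳ a b}} (gcd[m,n]≤n a b) ⟨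
    ∑< b (λ t → when (suc t ∣ᵇ gcd a b) (f (suc t)))          ≡⟨ ∑<-cong b split ⟩
    ∑∣ b (λ r → when (r ∣ᵇ a) (f r))                          ∎
    where
    open ≡-Reasoning
    split : ∀ t → when (suc t ∣ᵇ gcd a b) (f (suc t)) ≡ when (suc t ∣ᵇ b) (when (suc t ∣ᵇ a) (f (suc t)))
    split t = trans (when-does-⇔ (suc t ∣? gcd a b) ((suc t ∣? b) ×-dec (suc t ∣? a)) (f (suc t))
                       (λ r∣gcd → ∣-trans r∣gcd (gcd[m,n]∣n a b) , ∣-trans r∣gcd (gcd[m,n]∣m a b))
                       (λ (r∣b , r∣a) → gcd-greatest r∣a r∣b))
                    (sym (when-∧ (suc t ∣ᵇ b) (suc t ∣ᵇ a) (f (suc t))))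

  ∑∣-comm : ∀ M .{{_ : NonZero M}} (F : ℕ → ℕ → ℤ) →
    ∑∣ M (λ s → ∑∣ s (F s)) ≡ ∑∣ M (λ d → ∑∣ M (λ s → when (d ∣ᵇ s) (F s d)))
  ∑∣-comm M F = begin
    ∑∣ M (λ s → ∑∣ s (F s))
      ≡⟨ ∑<-cong M (λ s → when-does-cong (suc s ∣? M) (λ s+1∣M →
            sym (∑∣-extend (suc s) M (F (suc s)) (∣⇒≤ s+1∣M)))) ⟩
    ∑< M (λ s → when (suc s ∣ᵇ M) (∑< M (λ d → when (suc d ∣ᵇ suc s) (F (suc s) (suc d)))))
      ≡⟨ ∑<-cong M (λ s → when-∑< (suc s ∣ᵇ M) M (λ d → when (suc d ∣ᵇ suc s) (F (suc s) (suc d)))) ⟩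
    ∑< M (λ s → ∑< M (λ d → when (suc s ∣ᵇ M) (when (suc d ∣ᵇ suc s) (F (suc s) (suc d)))))
      ≡⟨ ∑<-comm M M (λ s d → when (suc s ∣ᵇ M) (when (suc d ∣ᵇ suc s) (F (suc s) (suc d)))) ⟩
    ∑< M (λ d → ∑∣ M (λ s → when (suc d ∣ᵇ s) (F s (suc d))))
      ≡⟨ ∑<-cong M restrict ⟩
    ∑∣ M (λ d → ∑∣ M (λ s → when (d ∣ᵇ s) (F s d))) ∎
    where
    open ≡-Reasoning
    restrict : ∀ d → ∑∣ M (λ s → when (suc d ∣ᵇ s) (F s (suc d)))
                   ≡ when (suc d ∣ᵇ M) (∑∣ M (λ s → when (suc d ∣ᵇ s) (F s (suc d))))
    restrict d = when-does-intro (suc d ∣? M) _ (λ d∤M → ∑<-zero M _ (λ s _ → vanish d∤M s (suc s ∣? M)))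
      where
      vanish : ¬ suc d ∣ M → ∀ s (s∣?M : Dec (suc s ∣ M)) →
        when (does s∣?M) (when (suc d ∣ᵇ suc s) (F (suc s) (suc d))) ≡ + 0
      vanish d∤M s (yes s∣M) = when-no (suc d ∣? suc s) _ (λ d∣s → d∤M (∣-trans d∣s s∣M))
      vanish d∤M s (no _)    = refl

  ∑∣-top : ∀ M .{{_ : NonZero M}} (f : ℕ → ℤ) → ∑∣ M (λ d → when (does (d ℕ.≟ M)) (f d)) ≡ f M
  ∑∣-top M@(suc m) f = begin
    ∑∣ M (λ d → when (does (d ℕ.≟ M)) (f d))
      ≡⟨ ∑<-single M m _ ℕP.≤-refl (λ t _ t≢m → when-zero′ t t≢m) ⟩
    when (M ∣ᵇ M) (when (does (M ℕ.≟ M)) (f M))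
      ≡⟨ when-yes (M ∣? M) _ ∣-refl ⟩
    when (does (M ℕ.≟ M)) (f M)
      ≡⟨ when-yes (M ℕ.≟ M) (f M) refl ⟩
    f M ∎
    where
    open ≡-Reasoning
    when-zero′ : ∀ t → t ≢ m → when (suc t ∣ᵇ M) (when (does (suc t ℕ.≟ M)) (f (suc t))) ≡ + 0
    when-zero′ t t≢m = trans (cong (when (suc t ∣ᵇ M)) (when-no (suc t ℕ.≟ M) (f (suc t)) (t≢m ∘ ℕP.suc-injective)))
                             (when-zero (suc t ∣ᵇ M))


module Möbius where

  open import Data.Nat as ℕ using (ℕ; zero; suc; _≤_; _<_; z≤n; s≤s; NonZero)
  import Data.Nat.Properties as ℕP
  open import Data.Nat.Divisibility
  open import Data.Nat.Primality
  open import Data.Nat.Primality.Factorisation using (factorise)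
  open import Data.Nat.Coprimality using (Coprime; coprime-divisor)
  open import Data.Integer as ℤ using (ℤ; +_; _+_; -_; -1ℤ; _^_)
  import Data.Integer.Properties as ℤP
  open import Data.Bool using (true; false; T; if_then_else_)
  open import Data.List as List using ([]; _∷_; applyUpTo; filter; length)
  open import Data.List.Relation.Unary.All using (_∷_)
  open import Data.List.Relation.Unary.Any.Properties using (any⁺; any⁻)
  open import Data.List.Membership.Propositional using (find; lose)
  open import Data.List.Membership.Propositional.Properties using (∈-filter⁺; ∈-filter⁻; ∈-upTo⁺)
  open import Data.Product using (∃-syntax; _×_; _,_; proj₂)
  open import Data.Sum using (inj₁; inj₂; [_,_]′)
  open import Function using (_∘_; id; _⇔_; mk⇔; Equivalence)
  open import Data.Bool.Properties using (T-≡)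
  open import Relation.Binary.PropositionalEquality
  open import Relation.Nullary using (Dec; yes; no; does; ¬_; contradiction)
  open import Relation.Nullary.Decidable using (toWitness; fromWitness; _×-dec_; ¬?; toSum; does-⇔; T?; ⌊_⌋)
  open import Defs using (μ; hasSquarePrimeFactor; primeDivisors; _div_)
  open RangeSum
  open DivisorSum

  prime-coprime : ∀ {p x} → Prime p → ¬ p ∣ x → Coprime x p
  prime-coprime pp p∤x (d∣x , d∣p) with prime⇒irreducible pp d∣p
  ... | inj₁ d≡1    = d≡1
  ... | inj₂ refl   = contradiction d∣x p∤x

  primeFactor : ∀ m → 1 < m → ∃[ p ] Prime p × p ∣ m
  primeFactor m 1<m with factorise m {{ℕ.>-nonZero (ℕP.<-trans (s≤s z≤n) 1<m)}}
  ... | record { factors = [] ; isFactorisation = m≡1 } = contradiction m≡1 (ℕP.>⇒≢ 1<m)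
  ... | record { factors = p ∷ _ ; isFactorisation = m≡p*_ ; factorsPrime = pp ∷ _ } =
    p , pp , subst (p ∣_) (sym m≡p*_) (m∣m*n _)

  T-injective : ∀ {b c} → (T b ⇔ T c) → b ≡ c
  T-injective {b} {c} T-iff = does-⇔ T-iff (T? b) (T? c)

  primeDivisor? : ∀ m q → Dec (Prime q × q ∣ m)
  primeDivisor? m q = prime? q ×-dec (q ∣? m)

  hasSquarePrimeFactor⇔ : ∀ u .{{_ : NonZero u}} →
    T (hasSquarePrimeFactor u) ⇔ (∃[ q ] Prime q × q ℕ.* q ∣ u)
  hasSquarePrimeFactor⇔ u = mk⇔ to from
    where
    squareDivides = λ q → ⌊ q ℕ.* q ∣? u ⌋
    to : T (hasSquarePrimeFactor u) → ∃[ q ] Prime q × q ℕ.* q ∣ u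
    to has with find (any⁻ squareDivides (primeDivisors u) has)
    ... | q , q∈ , qq∣u with ∈-filter⁻ (primeDivisor? u) {xs = List.upTo (suc u)} q∈
    ...   | _ , pq , _ = q , pq , toWitness qq∣u
    from : ∃[ q ] Prime q × q ℕ.* q ∣ u → T (hasSquarePrimeFactor u)
    from (q , pq , qq∣u) = any⁺ squareDivides (lose (∈-filter⁺ (primeDivisor? u) (∈-upTo⁺ (s≤s (∣⇒≤ q∣u))) (pq , q∣u))
                                        (fromWitness qq∣u))
      where q∣u = ∣-trans (m∣m*n q) qq∣u

  hasSquarePrimeFactor-*-∣ : ∀ {p u} .{{_ : NonZero u}} → Prime p → p ∣ u →
    hasSquarePrimeFactor (p ℕ.* u) ≡ true
  hasSquarePrimeFactor-*-∣ {p} {u} pp p∣u = Equivalence.to T-≡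
    (Equivalence.from (hasSquarePrimeFactor⇔ (p ℕ.* u) {{ℕP.m*n≢0 p u {{prime⇒nonZero pp}}}})
                      (p , pp , *-monoʳ-∣ p p∣u))

  hasSquarePrimeFactor-*-∤ : ∀ {p u} .{{_ : NonZero u}} → Prime p → ¬ p ∣ u →
    hasSquarePrimeFactor (p ℕ.* u) ≡ hasSquarePrimeFactor u
  hasSquarePrimeFactor-*-∤ {p} {u} pp p∤u = T-injective (mk⇔
    (Equivalence.from (hasSquarePrimeFactor⇔ u) ∘ cancel ∘ Equivalence.to (hasSquarePrimeFactor⇔ (p ℕ.* u) {{pu≢0}}))
    (Equivalence.from (hasSquarePrimeFactor⇔ (p ℕ.* u) {{pu≢0}}) ∘ extend ∘ Equivalence.to (hasSquarePrimeFactor⇔ u)))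
    where
    instance
      pu≢0 : NonZero (p ℕ.* u)
      pu≢0 = ℕP.m*n≢0 p u {{prime⇒nonZero pp}}
    p∤q² : ∀ {q} → Prime q → q ℕ.* q ∣ p ℕ.* u → ¬ p ∣ q ℕ.* q
    p∤q² {q} pq qq∣pu p∣qq with [ id , id ]′ (euclidsLemma q q pp p∣qq)
    ... | p∣q with prime⇒irreducible pq p∣q
    ...   | inj₁ refl = ¬prime[1] pp
    ...   | inj₂ refl = p∤u (*-cancelˡ-∣ p {{prime⇒nonZero pp}} qq∣pu)
    cancel : ∃[ q ] Prime q × q ℕ.* q ∣ p ℕ.* u → ∃[ q ] Prime q × q ℕ.* q ∣ u
    cancel (q , pq , qq∣pu) = q , pq , coprime-divisor (prime-coprime pp (p∤q² pq qq∣pu)) qq∣pu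
    extend : ∃[ q ] Prime q × q ℕ.* q ∣ u → ∃[ q ] Prime q × q ℕ.* q ∣ p ℕ.* u
    extend (q , pq , qq∣u) = q , pq , ∣n⇒∣m*n p qq∣u

  +length-filter : ∀ {p} {P : ℕ → Set p} (P? : ∀ x → Dec (P x)) (h : ℕ → ℕ) k →
    + length (filter P? (applyUpTo h k)) ≡ ∑< k (λ t → 𝟙 (P? (h t)))
  +length-filter P? h zero = refl
  +length-filter P? h (suc k) with does (P? (h 0))
  ... | true  = trans (ℤP.pos-+ 1 _) (cong (_+_ (+ 1)) (+length-filter P? (h ∘ suc) k))
  ... | false = trans (+length-filter P? (h ∘ suc) k) (sym (ℤP.+-identityˡ _))

  +length-primeDivisors : ∀ m → + length (primeDivisors m) ≡ ∑< (suc m) (λ q → 𝟙 (primeDivisor? m q))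
  +length-primeDivisors m = +length-filter (primeDivisor? m) id (suc m)

  𝟙-primeDivisor?-* : ∀ {p u} → Prime p → ¬ p ∣ u → ∀ t →
    𝟙 (primeDivisor? (p ℕ.* u) t) ≡ 𝟙 (primeDivisor? u t) + 𝟙 (t ℕ.≟ p)
  𝟙-primeDivisor?-* {p} {u} pp p∤u t with t ℕ.≟ p
  ... | yes refl = trans (when-yes (primeDivisor? (p ℕ.* u) p) (+ 1) (pp , m∣m*n u))
                         (sym (cong₂ _+_ (when-no (primeDivisor? u p) (+ 1) (p∤u ∘ proj₂))
                                         (when-yes (p ℕ.≟ p) (+ 1) refl)))
  ... | no t≢p = trans (when-does-⇔ (primeDivisor? (p ℕ.* u) t) (primeDivisor? u t) (+ 1) cancel extend)
                       (sym (trans (cong (_+_ (𝟙 (primeDivisor? u t))) (when-no (t ℕ.≟ p) (+ 1) t≢p))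
                                   (ℤP.+-identityʳ _)))
    where
    cancel : Prime t × t ∣ p ℕ.* u → Prime t × t ∣ u
    cancel (pt , t∣pu) with euclidsLemma p u pt t∣pu
    ... | inj₂ t∣u = pt , t∣u
    ... | inj₁ t∣p with prime⇒irreducible pp t∣p
    ...   | inj₁ refl = contradiction pt ¬prime[1]
    ...   | inj₂ t≡p  = contradiction t≡p t≢p
    extend : Prime t × t ∣ u → Prime t × t ∣ p ℕ.* u
    extend (pt , t∣u) = pt , ∣n⇒∣m*n p t∣u

  length-primeDivisors-* : ∀ {p u} .{{_ : NonZero u}} → Prime p → ¬ p ∣ u →
    length (primeDivisors (p ℕ.* u)) ≡ suc (length (primeDivisors u))
  length-primeDivisors-* {p} {u} pp p∤u = ℤP.+-injective (begin
    + length (primeDivisors (p ℕ.* u))                         ≡⟨ +length-primeDivisors (p ℕ.* u) ⟩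
    ∑< (suc (p ℕ.* u)) (λ t → 𝟙 (primeDivisor? (p ℕ.* u) t))   ≡⟨ ∑<-cong (suc (p ℕ.* u)) (𝟙-primeDivisor?-* pp p∤u) ⟩
    ∑< (suc (p ℕ.* u)) (λ t → isPrimeDivisor t + isP t)         ≡⟨ ∑<-distrib-+ (suc (p ℕ.* u)) isPrimeDivisor isP ⟩
    ∑< (suc (p ℕ.* u)) isPrimeDivisor + ∑< (suc (p ℕ.* u)) isP
      ≡⟨ cong₂ _+_ (∑<-extend (suc u) (suc (p ℕ.* u)) isPrimeDivisor (s≤s u≤pu) beyond)
                   (∑<-single (suc (p ℕ.* u)) p isP (s≤s (ℕP.m≤m*n p u)) (λ t _ t≢p → when-no (t ℕ.≟ p) (+ 1) t≢p)) ⟩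
    ∑< (suc u) isPrimeDivisor + isP p                           ≡⟨ cong₂ _+_ (+length-primeDivisors u) (sym (when-yes (p ℕ.≟ p) (+ 1) refl)) ⟨
    + length (primeDivisors u) + + 1                            ≡⟨ ℤP.+-comm (+ length (primeDivisors u)) (+ 1) ⟩
    + suc (length (primeDivisors u))                            ∎)
    where
    open ≡-Reasoning
    isPrimeDivisor isP : ℕ → ℤ
    isPrimeDivisor t = 𝟙 (primeDivisor? u t)
    isP t = 𝟙 (t ℕ.≟ p)
    u≤pu : u ≤ p ℕ.* u
    u≤pu = ℕP.m≤n*m u p {{prime⇒nonZero pp}}
    beyond : ∀ t → suc u ≤ t → t < suc (p ℕ.* u) → isPrimeDivisor t ≡ + 0
    beyond t u<t _ = when-no (primeDivisor? u t) (+ 1) (λ (_ , t∣u) → ℕP.<⇒≱ u<t (∣⇒≤ t∣u))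

  μ-* : ∀ {p u} .{{_ : NonZero u}} → Prime p → μ (p ℕ.* u) ≡ when (does (¬? (p ∣? u))) (- μ u)
  μ-* {p} {u} pp = [ divisible , coprime ]′ (toSum (p ∣? u))
    where
    divisible : p ∣ u → μ (p ℕ.* u) ≡ when (does (¬? (p ∣? u))) (- μ u)
    divisible p∣u = trans (cong (if_then + 0 else -1ℤ ^ length (primeDivisors (p ℕ.* u)))
                                (hasSquarePrimeFactor-*-∣ pp p∣u))
                          (sym (when-no (¬? (p ∣? u)) (- μ u) (λ p∤u → p∤u p∣u)))
    coprime : ¬ p ∣ u → μ (p ℕ.* u) ≡ when (does (¬? (p ∣? u))) (- μ u)
    coprime p∤u = begin
      μ (p ℕ.* u)
        ≡⟨ cong₂ (λ b k → if b then + 0 else -1ℤ ^ k)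
                 (hasSquarePrimeFactor-*-∤ pp p∤u) (length-primeDivisors-* pp p∤u) ⟩
      (if hasSquarePrimeFactor u then + 0 else -1ℤ ^ suc (length (primeDivisors u)))
        ≡⟨ negate (hasSquarePrimeFactor u) ⟩
      - μ u
        ≡⟨ when-yes (¬? (p ∣? u)) (- μ u) p∤u ⟨
      when (does (¬? (p ∣? u))) (- μ u) ∎
      where
      open ≡-Reasoning
      negate : ∀ b → (if b then + 0 else -1ℤ ^ suc (length (primeDivisors u)))
                   ≡ - (if b then + 0 else -1ℤ ^ length (primeDivisors u))
      negate true  = refl
      negate false = ℤP.-1*i≡-i _

  ∑∣-μ-prime-multiple : ∀ {p} q .{{_ : NonZero q}} → Prime p → ∑∣ (p ℕ.* q) μ ≡ + 0
  ∑∣-μ-prime-multiple {p@(suc p′)} q pp = begin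
    ∑∣ (p ℕ.* q) μ
      ≡⟨ ∑∣-cong (p ℕ.* q) (λ d _ → sym (when-¬?+when (p ∣? d) (μ d))) ⟩
    ∑∣ (p ℕ.* q) (λ d → coprimePart d + when (p ∣ᵇ d) (μ d))
      ≡⟨ ∑∣-distrib-+ (p ℕ.* q) coprimePart (λ d → when (p ∣ᵇ d) (μ d)) ⟩
    ∑∣ (p ℕ.* q) coprimePart + ∑∣ (p ℕ.* q) (λ d → when (p ∣ᵇ d) (μ d))
      ≡⟨ cong₂ _+_ coprimeDivisors multipleDivisors ⟩
    ∑∣ q coprimePart + - ∑∣ q coprimePart
      ≡⟨ ℤP.+-inverseʳ (∑∣ q coprimePart) ⟩
    + 0 ∎
    where
    open ≡-Reasoning
    coprimePart : ℕ → ℤ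
    coprimePart d = when (does (¬? (p ∣? d))) (μ d)
    restrict : ∀ m t → when (suc t ∣ᵇ m) (coprimePart (suc t))
                     ≡ when (does ((suc t ∣? m) ×-dec ¬? (p ∣? suc t))) (μ (suc t))
    restrict m t = when-∧ (suc t ∣ᵇ m) (does (¬? (p ∣? suc t))) (μ (suc t))
    coprimeDivisors : ∑∣ (p ℕ.* q) coprimePart ≡ ∑∣ q coprimePart
    coprimeDivisors = begin
      ∑∣ (p ℕ.* q) coprimePart
        ≡⟨ ∑<-cong (p ℕ.* q) (λ t → trans (restrict (p ℕ.* q) t) (trans
             (when-does-⇔ ((suc t ∣? p ℕ.* q) ×-dec ¬? (p ∣? suc t)) ((suc t ∣? q) ×-dec ¬? (p ∣? suc t)) (μ (suc t))
                (λ (t∣pq , p∤t) → coprime-divisor (prime-coprime pp p∤t) t∣pq , p∤t)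
                (λ (t∣q , p∤t) → ∣n⇒∣m*n p t∣q , p∤t))
             (sym (restrict q t)))) ⟩
      ∑< (p ℕ.* q) (λ t → when (suc t ∣ᵇ q) (coprimePart (suc t)))
        ≡⟨ ∑∣-extend q (p ℕ.* q) coprimePart (ℕP.m≤n*m q p) ⟩
      ∑∣ q coprimePart ∎
    multipleDivisors : ∑∣ (p ℕ.* q) (λ d → when (p ∣ᵇ d) (μ d)) ≡ - ∑∣ q coprimePart
    multipleDivisors = begin
      ∑∣ (p ℕ.* q) (λ d → when (p ∣ᵇ d) (μ d))   ≡⟨ ∑∣-multiples p′ q μ ⟩
      ∑∣ q (λ u → μ (p ℕ.* u))                   ≡⟨ ∑∣-cong q (λ u u∣q → trans (μ-* {{∣-nonZero u∣q}} pp)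
                                                       (when-neg (does (¬? (p ∣? u))) (μ u))) ⟩
      ∑∣ q (λ u → - coprimePart u)               ≡⟨ neg-distrib-∑∣ q coprimePart ⟨
      - ∑∣ q coprimePart                         ∎

  ∑∣-μ : ∀ m .{{_ : NonZero m}} → ∑∣ m μ ≡ 𝟙 (m ℕ.≟ 1)
  ∑∣-μ 1 = refl
  ∑∣-μ m@(suc (suc _)) with primeFactor m (s≤s (s≤s z≤n))
  ... | p , pp , divides q m≡q*p = begin
    ∑∣ m μ              ≡⟨ cong (λ k → ∑∣ k μ) (trans m≡q*p (ℕP.*-comm q p)) ⟩
    ∑∣ (p ℕ.* q) μ      ≡⟨ ∑∣-μ-prime-multiple q {{q≢0}} pp ⟩
    + 0                 ≡⟨ when-no (m ℕ.≟ 1) (+ 1) (λ ()) ⟨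
    𝟙 (m ℕ.≟ 1) ∎
    where
    open ≡-Reasoning
    q≢0 : NonZero q
    q≢0 = ℕP.m*n≢0⇒m≢0 q {{subst NonZero m≡q*p _}}

  ∑∣-μ-complement : ∀ m .{{_ : NonZero m}} → ∑∣ m (λ d → μ (m div d)) ≡ 𝟙 (m ℕ.≟ 1)
  ∑∣-μ-complement m = trans (∑∣-complement m μ) (∑∣-μ m)

  private
    quotient≡1⇔ : ∀ d q .{{_ : NonZero d}} (x : ℤ) →
      when (does (q ℕ.≟ 1)) x ≡ when (does (d ℕ.≟ d ℕ.* q)) x
    quotient≡1⇔ d q x = when-does-⇔ (q ℕ.≟ 1) (d ℕ.≟ d ℕ.* q) x
      (λ { refl → sym (ℕP.*-identityʳ d) })
      (λ d≡dq → ℕP.*-cancelˡ-≡ q 1 d (trans (sym d≡dq) (sym (ℕP.*-identityʳ d))))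

  ∑∣-μ-multiples : ∀ d M .{{_ : NonZero M}} → d ∣ M →
    ∑∣ M (λ s → when (d ∣ᵇ s) (μ (s div d))) ≡ 𝟙 (d ℕ.≟ M)
  ∑∣-μ-multiples zero M 0∣M = contradiction (0∣⇒≡0 0∣M) (ℕ.≢-nonZero⁻¹ M)
  ∑∣-μ-multiples d@(suc d′) M d∣M = begin
    ∑∣ M (λ s → when (d ∣ᵇ s) (μ (s div d)))
      ≡⟨ cong (λ k → ∑∣ k (λ s → when (d ∣ᵇ s) (μ (s div d)))) M≡dq ⟩
    ∑∣ (d ℕ.* q) (λ s → when (d ∣ᵇ s) (μ (s div d)))
      ≡⟨ ∑∣-multiples d′ q (λ s → μ (s div d)) ⟩
    ∑∣ q (λ u → μ ((d ℕ.* u) div d))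
      ≡⟨ ∑∣-cong q (λ u _ → cong μ (m*n-div-m≡n d u)) ⟩
    ∑∣ q μ
      ≡⟨ ∑∣-μ q {{quotient≢0 d∣M}} ⟩
    𝟙 (q ℕ.≟ 1)
      ≡⟨ quotient≡1⇔ d q (+ 1) ⟩
    𝟙 (d ℕ.≟ d ℕ.* q)
      ≡⟨ cong (λ k → 𝟙 (d ℕ.≟ k)) M≡dq ⟨
    𝟙 (d ℕ.≟ M) ∎
    where
    open ≡-Reasoning
    q = quotient d∣M
    M≡dq : M ≡ d ℕ.* q
    M≡dq = m∣n⇒n≡m*quotient d∣M

  ∑∣-μ-complement-multiples : ∀ r s .{{_ : NonZero s}} → r ∣ s →
    ∑∣ s (λ d → when (r ∣ᵇ d) (μ (s div d))) ≡ 𝟙 (r ℕ.≟ s)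
  ∑∣-μ-complement-multiples zero s 0∣s = contradiction (0∣⇒≡0 0∣s) (ℕ.≢-nonZero⁻¹ s)
  ∑∣-μ-complement-multiples r@(suc r′) s r∣s = begin
    ∑∣ s (λ d → when (r ∣ᵇ d) (μ (s div d)))
      ≡⟨ cong (λ k → ∑∣ k (λ d → when (r ∣ᵇ d) (μ (k div d)))) s≡rq ⟩
    ∑∣ (r ℕ.* q) (λ d → when (r ∣ᵇ d) (μ ((r ℕ.* q) div d)))
      ≡⟨ ∑∣-multiples r′ q (λ d → μ ((r ℕ.* q) div d)) ⟩
    ∑∣ q (λ u → μ ((r ℕ.* q) div (r ℕ.* u)))
      ≡⟨ ∑∣-cong q (λ u _ → cong μ (m*n-div-m*o≡n-div-o r q u)) ⟩
    ∑∣ q (λ u → μ (q div u))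
      ≡⟨ ∑∣-μ-complement q {{quotient≢0 r∣s}} ⟩
    𝟙 (q ℕ.≟ 1)
      ≡⟨ quotient≡1⇔ r q (+ 1) ⟩
    𝟙 (r ℕ.≟ r ℕ.* q)
      ≡⟨ cong (λ k → 𝟙 (r ℕ.≟ k)) s≡rq ⟨
    𝟙 (r ℕ.≟ s) ∎
    where
    open ≡-Reasoning
    q = quotient r∣s
    s≡rq : s ≡ r ℕ.* q
    s≡rq = m∣n⇒n≡m*quotient r∣s

  private
    ∑∣-indicator : ∀ M .{{_ : NonZero M}} (F : ℕ → ℤ) →
      ∑∣ M (λ d → 𝟙 (d ℕ.≟ M) ℤ.* F d) ≡ F M
    ∑∣-indicator M F = trans (∑∣-cong M (λ d _ → trans (when-*ˡ (does (d ℕ.≟ M)) (+ 1) (F d))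
                                                        (cong (when (does (d ℕ.≟ M))) (ℤP.*-identityˡ (F d)))))
                             (∑∣-top M F)

  möbius-inversion : ∀ M .{{_ : NonZero M}} (F : ℕ → ℤ) →
    ∑∣ M (λ s → ∑∣ s (λ d → μ (s div d) ℤ.* F d)) ≡ F M
  möbius-inversion M F = begin
    ∑∣ M (λ s → ∑∣ s (λ d → μ (s div d) ℤ.* F d))
      ≡⟨ ∑∣-comm M (λ s d → μ (s div d) ℤ.* F d) ⟩
    ∑∣ M (λ d → ∑∣ M (λ s → when (d ∣ᵇ s) (μ (s div d) ℤ.* F d)))
      ≡⟨ ∑∣-cong M (λ d _ → trans (∑∣-cong M (λ s _ → sym (when-*ˡ (d ∣ᵇ s) (μ (s div d)) (F d))))
                                  (sym (*-distribʳ-∑∣ M (F d) (λ s → when (d ∣ᵇ s) (μ (s div d)))))) ⟩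
    ∑∣ M (λ d → ∑∣ M (λ s → when (d ∣ᵇ s) (μ (s div d))) ℤ.* F d)
      ≡⟨ ∑∣-cong M (λ d d∣M → cong (ℤ._* F d) (∑∣-μ-multiples d M d∣M)) ⟩
    ∑∣ M (λ d → 𝟙 (d ℕ.≟ M) ℤ.* F d)
      ≡⟨ ∑∣-indicator M F ⟩
    F M ∎
    where open ≡-Reasoning

  möbius-inversion′ : ∀ s .{{_ : NonZero s}} (f : ℕ → ℤ) →
    ∑∣ s (λ d → μ (s div d) ℤ.* ∑∣ d f) ≡ f s
  möbius-inversion′ s f = begin
    ∑∣ s (λ d → μ (s div d) ℤ.* ∑∣ d f)
      ≡⟨ ∑∣-cong s (λ d _ → *-distribˡ-∑∣ d (μ (s div d)) f) ⟩
    ∑∣ s (λ d → ∑∣ d (λ r → μ (s div d) ℤ.* f r))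
      ≡⟨ ∑∣-comm s (λ d r → μ (s div d) ℤ.* f r) ⟩
    ∑∣ s (λ r → ∑∣ s (λ d → when (r ∣ᵇ d) (μ (s div d) ℤ.* f r)))
      ≡⟨ ∑∣-cong s (λ r _ → trans (∑∣-cong s (λ d _ → sym (when-*ˡ (r ∣ᵇ d) (μ (s div d)) (f r))))
                                  (sym (*-distribʳ-∑∣ s (f r) (λ d → when (r ∣ᵇ d) (μ (s div d)))))) ⟩
    ∑∣ s (λ r → ∑∣ s (λ d → when (r ∣ᵇ d) (μ (s div d))) ℤ.* f r)
      ≡⟨ ∑∣-cong s (λ r r∣s → cong (ℤ._* f r) (∑∣-μ-complement-multiples r s r∣s)) ⟩
    ∑∣ s (λ r → 𝟙 (r ℕ.≟ s) ℤ.* f r)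
      ≡⟨ ∑∣-indicator s f ⟩
    f s ∎
    where open ≡-Reasoning


module FiniteGroup (G : Defs.FiniteAbelianGroup) where

  open import Level using (0ℓ)
  open import Data.Nat as ℕ using (ℕ; zero; suc)
  open import Data.Bool using (true; false)
  open import Data.Integer as ℤ using (ℤ; +_)
  import Data.Integer.Properties as ℤP
  open import Data.Fin using (Fin; toℕ)
  open import Data.Fin.Permutation using (Permutation; permutation)
  open import Function using (_∘_; Inverse)
  open import Algebra.Bundles using (AbelianGroup)
  import Algebra.Properties.AbelianGroup as AbelianGroupProperties
  import Algebra.Properties.CommutativeMonoid.Sum as CommutativeMonoidSum
  import Algebra.Properties.Semiring.Sum as SemiringSum
  import Algebra.Properties.Monoid.Mult as MonoidMult
  import Algebra.Properties.CommutativeMonoid.Mult as CommutativeMonoidMult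
  open import Relation.Binary.PropositionalEquality
  open RangeSum

  open Defs.FiniteAbelianGroup G public

  private
    module ℤΣ = SemiringSum ℤP.+-*-semiring

  abelianGroup : AbelianGroup 0ℓ 0ℓ
  abelianGroup = record { isAbelianGroup = isAbelianGroup }

  open AbelianGroup abelianGroup public using (assoc; comm; identityˡ; identityʳ; inverseˡ; inverseʳ)
  open AbelianGroupProperties abelianGroup public using (∙-cancelˡ; ∙-cancelʳ; inverseʳ-unique; ⁻¹-∙-comm; x≈z//y)
  open MonoidMult (AbelianGroup.monoid abelianGroup) using (_×_; ×-homo-+; ×-assocˡ)
  open CommutativeMonoidMult (AbelianGroup.commutativeMonoid abelianGroup) using (×-distrib-+)

  n : ℕ
  n = order

  el : Fin n → Carrier
  el = Inverse.to enum

  fr : Carrier → Fin n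
  fr = Inverse.from enum

  infixl 6 _-_
  _-_ : Carrier → Carrier → Carrier
  x - y = x + - y

  -+-cancel : ∀ x y → x - y + y ≡ x
  -+-cancel x y = trans (assoc x (- y) y) (trans (cong (_+_ x) (inverseˡ y)) (identityʳ x))

  +--cancel : ∀ x y → x + y - y ≡ x
  +--cancel x y = trans (assoc x y (- y)) (trans (cong (_+_ x) (inverseʳ y)) (identityʳ x))

  +≡⇒≡- : ∀ x y g → x + y ≡ g → y ≡ g - x
  +≡⇒≡- x y g x+y≡g = x≈z//y y x g (trans (comm y x) x+y≡g)

  ≡-⇒+≡ : ∀ x y g → y ≡ g - x → x + y ≡ g
  ≡-⇒+≡ x y g refl = trans (comm x (g - x)) (-+-cancel g x)

  -‿-+ : ∀ a b c → a - (b + c) ≡ a - c - b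
  -‿-+ a b c = trans (cong (_+_ a) (trans (sym (⁻¹-∙-comm b c)) (comm (- b) (- c)))) (sym (assoc a (- c) (- b)))

  -‿-comm : ∀ a b c → a - b - c ≡ a - c - b
  -‿-comm a b c = trans (assoc a (- b) (- c)) (trans (cong (_+_ a) (comm (- b) (- c))) (sym (assoc a (- c) (- b))))

  ·≡× : ∀ d h → d · h ≡ d × h
  ·≡× zero    h = refl
  ·≡× (suc d) h = cong (_+_ h) (·≡× d h)

  ·-distribʳ-+ : ∀ a b h → (a ℕ.+ b) · h ≡ a · h + b · h
  ·-distribʳ-+ a b h = trans (·≡× (a ℕ.+ b) h)
    (trans (×-homo-+ h a b) (sym (cong₂ _+_ (·≡× a h) (·≡× b h))))

  ·-assoc : ∀ a b h → (a ℕ.* b) · h ≡ a · (b · h)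
  ·-assoc a b h = trans (·≡× (a ℕ.* b) h)
    (trans (sym (×-assocˡ h a b)) (sym (trans (·≡× a (b · h)) (cong (a ×_) (·≡× b h)))))

  ·-distribˡ-+ : ∀ a h k → a · (h + k) ≡ a · h + a · k
  ·-distribˡ-+ a h k = trans (·≡× a (h + k))
    (trans (×-distrib-+ h k a) (sym (cong₂ _+_ (·≡× a h) (·≡× a k))))

  ·-zeroʳ : ∀ a → a · 0# ≡ 0#
  ·-zeroʳ zero    = refl
  ·-zeroʳ (suc a) = trans (identityˡ _) (·-zeroʳ a)

  ·-neg : ∀ a h → a · (- h) ≡ - (a · h)
  ·-neg a h = inverseʳ-unique (a · h) (a · (- h))
    (trans (sym (·-distribˡ-+ a h (- h))) (trans (cong (a ·_) (inverseʳ h)) (·-zeroʳ a)))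

  ·-distribˡ-- : ∀ a h k → a · (h - k) ≡ a · h - a · k
  ·-distribˡ-- a h k = trans (·-distribˡ-+ a h (- k)) (cong (_+_ (a · h)) (·-neg a k))

  permutationOf : (φ ψ : Carrier → Carrier) → (∀ x → φ (ψ x) ≡ x) → (∀ x → ψ (φ x) ≡ x) → Permutation n n
  permutationOf φ ψ φψ ψφ = permutation (fr ∘ φ ∘ el) (fr ∘ ψ ∘ el) (inv φ ψ φψ) (inv ψ φ ψφ)
    where
    inv : ∀ φ ψ → (∀ x → φ (ψ x) ≡ x) → ∀ j → fr (φ (el (fr (ψ (el j))))) ≡ j
    inv φ ψ φψ j = trans (cong (fr ∘ φ) (Inverse.strictlyInverseˡ enum _))
                         (trans (cong fr (φψ (el j))) (Inverse.strictlyInverseʳ enum j))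

  lagrange : ∀ h → n · h ≡ 0#
  lagrange h = ∙-cancelˡ S (n · h) 0# (begin
    S + n · h                   ≡⟨ cong (_+_ S) (·≡× n h) ⟩
    S + n × h                   ≡⟨ cong (_+_ S) (GΣ.sum-replicate n) ⟨
    S + GΣ.sum {n} (λ _ → h)    ≡⟨ GΣ.∑-distrib-+ {n} el (λ _ → h) ⟨
    GΣ.sum {n} (λ j → el j + h) ≡⟨ GΣ.sum-cong-≗ {n} (λ j → Inverse.strictlyInverseˡ enum (el j + h)) ⟨
    GΣ.sum {n} fr-translate     ≡⟨ GΣ.sum-permute {n} el (permutationOf (_+ h) (_- h) (λ x → -+-cancel x h) (λ x → +--cancel x h)) ⟨
    S                           ≡⟨ identityʳ S ⟨
    S + 0#                      ∎)
    where
    open ≡-Reasoning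
    module GΣ = CommutativeMonoidSum (AbelianGroup.commutativeMonoid abelianGroup)
    S = GΣ.sum {n} el
    fr-translate : Fin n → Carrier
    fr-translate j = el (fr (el j + h))

  shiftSum : ∀ {m} → (Fin m → Carrier) → ℕ → (Carrier → ℤ) → Carrier → ℤ
  shiftSum {m} v k f g = ℤΣ.sum {m} (λ j → f (g - k · v j))

  shiftSum-cong : ∀ {m} (v : Fin m → Carrier) k {f f′ : Carrier → ℤ} → (∀ y → f y ≡ f′ y) → ∀ g →
    shiftSum v k f g ≡ shiftSum v k f′ g
  shiftSum-cong {m} v k eq g = ℤΣ.sum-cong-≗ {m} (λ j → eq (g - k · v j))

  ∑G : (Carrier → ℤ) → ℤ
  ∑G f = ℤΣ.sum {n} (f ∘ el)

  ∑G-cong : ∀ {f g : Carrier → ℤ} → (∀ h → f h ≡ g h) → ∑G f ≡ ∑G g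
  ∑G-cong eq = ℤΣ.sum-cong-≗ {n} (eq ∘ el)

  ∑G-bijection : (φ ψ : Carrier → Carrier) → (∀ x → φ (ψ x) ≡ x) → (∀ x → ψ (φ x) ≡ x) →
    ∀ (f : Carrier → ℤ) → ∑G (f ∘ φ) ≡ ∑G f
  ∑G-bijection φ ψ φψ ψφ f = sym (trans (ℤΣ.sum-permute {n} (f ∘ el) (permutationOf φ ψ φψ ψφ))
    (ℤΣ.sum-cong-≗ {n} (λ j → cong f (Inverse.strictlyInverseˡ enum (φ (el j))))))

  ∑G-translate : ∀ t (f : Carrier → ℤ) → ∑G (λ h → f (h + t)) ≡ ∑G f
  ∑G-translate t = ∑G-bijection (_+ t) (_- t) (λ x → -+-cancel x t) (λ x → +--cancel x t)

  ∑G-comm : ∀ (f : Carrier → Carrier → ℤ) → ∑G (λ h → ∑G (f h)) ≡ ∑G (λ h′ → ∑G (λ h → f h h′))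
  ∑G-comm f = ℤΣ.∑-comm {n} {n} (λ i j → f (el i) (el j))

  ∑G-∑<-comm : ∀ b (f : Carrier → ℕ → ℤ) → ∑G (λ h → ∑< b (f h)) ≡ ∑< b (λ t → ∑G (λ h → f h t))
  ∑G-∑<-comm b f = ℤΣ.∑-comm {n} {b} (λ i j → f (el i) (toℕ j))

  ∑G-const : ∀ c → ∑G (λ _ → c) ≡ + n ℤ.* c
  ∑G-const = ∑<-const n

  *-distribˡ-∑G : ∀ c (f : Carrier → ℤ) → c ℤ.* ∑G f ≡ ∑G (λ h → c ℤ.* f h)
  *-distribˡ-∑G c f = ℤΣ.*-distribˡ-sum {n} c (f ∘ el)

  when-∑G : ∀ b (f : Carrier → ℤ) → when b (∑G f) ≡ ∑G (λ h → when b (f h))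
  when-∑G true  f = refl
  when-∑G false f = sym (ℤΣ.sum-replicate-zero n)


module Euclid where

  open import Data.Nat as ℕ using (ℕ; zero; suc; _+_; _<_; _∸_; s≤s)
  import Data.Nat.Properties as ℕP
  open import Data.Nat.Induction using (<-rec)
  open import Data.Nat.GCD using (gcd; gcd-GCD; gcd-comm; gcd-identityˡ; module GCD)
  open import Data.Sum using ([_,_]′)
  open import Relation.Binary.PropositionalEquality

  gcd[m,m+n]≡gcd[m,n] : ∀ m n → gcd m (m + n) ≡ gcd m n
  gcd[m,m+n]≡gcd[m,n] m n = GCD.unique (gcd-GCD m (m + n)) (GCD.step (gcd-GCD m n))

  shear-invariant⇒gcd-invariant : ∀ {a} {A : Set a} (F : ℕ → ℕ → A) →
    (∀ k d → F k d ≡ F d k) → (∀ k d → F k (k + d) ≡ F k d) → ∀ k d → F k d ≡ F (gcd k d) 0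
  shear-invariant⇒gcd-invariant F F-comm F-shear k d = <-rec P step (k + d) k d refl
    where
    P : ℕ → Set _
    P s = ∀ k d → k + d ≡ s → F k d ≡ F (gcd k d) 0

    -- one step of the subtractive Euclidean algorithm, for k ≤ d
    reduce : ∀ s → (∀ {s′} → s′ < s → P s′) → ∀ k d → suc k + suc d ≡ s → k ℕ.≤ d →
             F (suc k) (suc d) ≡ F (gcd (suc k) (suc d)) 0
    reduce s rec k d eq k≤d = begin
      F (suc k) (suc d)                 ≡⟨ cong (F (suc k)) d≡k+r ⟩
      F (suc k) (suc k + r)             ≡⟨ F-shear (suc k) r ⟩
      F (suc k) r                       ≡⟨ rec smaller (suc k) r refl ⟩
      F (gcd (suc k) r) 0               ≡⟨ cong (λ x → F x 0) (gcd[m,m+n]≡gcd[m,n] (suc k) r) ⟨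
      F (gcd (suc k) (suc k + r)) 0     ≡⟨ cong (λ x → F (gcd (suc k) x) 0) d≡k+r ⟨
      F (gcd (suc k) (suc d)) 0         ∎
      where
      open ≡-Reasoning
      r = suc d ∸ suc k
      d≡k+r : suc d ≡ suc k + r
      d≡k+r = sym (ℕP.m+[n∸m]≡n (s≤s k≤d))
      smaller : suc k + r < s
      smaller = subst (suc k + r <_) eq (ℕP.+-monoʳ-< (suc k) (s≤s (ℕP.m∸n≤m d k)))

    step : ∀ s → (∀ {s′} → s′ < s → P s′) → P s
    step s rec zero    d       _  = trans (F-comm 0 d) (cong (λ x → F x 0) (sym (gcd-identityˡ d)))
    step s rec (suc k) zero    _  = refl
    step s rec (suc k) (suc d) eq = [ reduce s rec k d eq , swap ]′ (ℕP.≤-total k d)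
      where
      swap : d ℕ.≤ k → F (suc k) (suc d) ≡ F (gcd (suc k) (suc d)) 0
      swap d≤k = trans (F-comm (suc k) (suc d))
        (trans (reduce s rec d k (trans (ℕP.+-comm (suc d) (suc k)) eq) d≤k)
               (cong (λ x → F x 0) (gcd-comm (suc d) (suc k))))


module Convolution (G : Defs.FiniteAbelianGroup) where

  open import Data.Nat as ℕ using (ℕ)
  open import Data.Nat.GCD using (gcd)
  open import Data.Integer as ℤ using (ℤ)
  open import Relation.Binary.PropositionalEquality
  open RangeSum
  open FiniteGroup G
  open Euclid using (shear-invariant⇒gcd-invariant)

  solutions : ℕ → Carrier → ℤ
  solutions d g = ∑G (λ h → 𝟙 ((d · h) ≟ g))

  linearSolutions : ℕ → ℕ → Carrier → ℤ
  linearSolutions k d g = ∑G (λ h → ∑G (λ h′ → 𝟙 ((k · h + d · h′) ≟ g)))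

  𝟙-≟-cong : ∀ {x y} g → x ≡ y → 𝟙 (x ≟ g) ≡ 𝟙 (y ≟ g)
  𝟙-≟-cong g refl = refl

  shiftSum-solutions≡linearSolutions : ∀ k d g → shiftSum el k (solutions d) g ≡ linearSolutions k d g
  shiftSum-solutions≡linearSolutions k d g = ∑G-cong (λ h → ∑G-cong (λ h′ →
    when-does-⇔ ((d · h′) ≟ (g - k · h)) ((k · h + d · h′) ≟ g) (ℤ.+ 1)
      (≡-⇒+≡ (k · h) (d · h′) g) (+≡⇒≡- (k · h) (d · h′) g)))

  linearSolutions-comm : ∀ k d g → linearSolutions k d g ≡ linearSolutions d k g
  linearSolutions-comm k d g = trans (∑G-comm (λ h h′ → 𝟙 ((k · h + d · h′) ≟ g)))
    (∑G-cong (λ h′ → ∑G-cong (λ h → 𝟙-≟-cong g (comm (k · h) (d · h′)))))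

  -- substituting h ↦ h + h′ turns k h + (k + d) h′ into k h + d h′
  linearSolutions-shear : ∀ k d g → linearSolutions k (k ℕ.+ d) g ≡ linearSolutions k d g
  linearSolutions-shear k d g = begin
    linearSolutions k (k ℕ.+ d) g
      ≡⟨ ∑G-comm (λ h h′ → 𝟙 ((k · h + (k ℕ.+ d) · h′) ≟ g)) ⟩
    ∑G (λ h′ → ∑G (λ h → 𝟙 ((k · h + (k ℕ.+ d) · h′) ≟ g)))
      ≡⟨ ∑G-cong (λ h′ → trans (∑G-cong (λ h → 𝟙-≟-cong g (regroup h h′)))
                              (∑G-translate h′ (λ h → 𝟙 ((k · h + d · h′) ≟ g)))) ⟩
    ∑G (λ h′ → ∑G (λ h → 𝟙 ((k · h + d · h′) ≟ g)))
      ≡⟨ ∑G-comm (λ h h′ → 𝟙 ((k · h + d · h′) ≟ g)) ⟨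
    linearSolutions k d g ∎
    where
    open ≡-Reasoning
    regroup : ∀ h h′ → k · h + (k ℕ.+ d) · h′ ≡ k · (h + h′) + d · h′
    regroup h h′ = begin
      k · h + (k ℕ.+ d) · h′     ≡⟨ cong (_+_ (k · h)) (·-distribʳ-+ k d h′) ⟩
      k · h + (k · h′ + d · h′)  ≡⟨ assoc (k · h) (k · h′) (d · h′) ⟨
      k · h + k · h′ + d · h′    ≡⟨ cong (_+ d · h′) (·-distribˡ-+ k h h′) ⟨
      k · (h + h′) + d · h′      ∎

  linearSolutions-zero : ∀ k g → linearSolutions k 0 g ≡ ℤ.+ n ℤ.* solutions k g
  linearSolutions-zero k g = trans (∑G-cong (λ h → trans (∑G-cong (λ _ → 𝟙-≟-cong g (identityʳ (k · h))))
                                                         (∑G-const (𝟙 ((k · h) ≟ g)))))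
                                   (sym (*-distribˡ-∑G (ℤ.+ n) (λ h → 𝟙 ((k · h) ≟ g))))

  shiftSum-solutions : ∀ k d g → shiftSum el k (solutions d) g ≡ ℤ.+ n ℤ.* solutions (gcd k d) g
  shiftSum-solutions k d g = begin
    shiftSum el k (solutions d) g       ≡⟨ shiftSum-solutions≡linearSolutions k d g ⟩
    linearSolutions k d g           ≡⟨ shear-invariant⇒gcd-invariant (λ k d → linearSolutions k d g)
                                         (λ k d → linearSolutions-comm k d g) (λ k d → linearSolutions-shear k d g) k d ⟩
    linearSolutions (gcd k d) 0 g   ≡⟨ linearSolutions-zero (gcd k d) g ⟩
    ℤ.+ n ℤ.* solutions (gcd k d) g ∎
    where open ≡-Reasoning


module Torsion (G : Defs.FiniteAbelianGroup) where

  open import Data.Nat as ℕ using (ℕ; zero; suc; _≤_; _<_; s≤s; z≤n; NonZero)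
  import Data.Nat.Properties as ℕP
  open import Data.Nat.Divisibility
  open import Data.Nat.DivMod using (_/_; _%_; m/n*n≡m; m≡m%n+[m/n]*n; m%n<n)
  open import Data.Nat.GCD using (gcd; gcd[m,n]∣m; gcd[m,n]∣n; module Bézout)
  open import Data.Nat.LCM using (lcm; lcm-least; gcd*lcm; m∣lcm[m,n]; n∣lcm[m,n])
  open import Data.Nat.Coprimality using (coprime-/gcd; coprime-Bézout)
  open import Data.Nat.Tactic.RingSolver using (solve-∀)
  open import Data.Integer as ℤ using (ℤ; +_)
  import Data.Integer.Properties as ℤP
  open import Data.Fin as Fin using (Fin)
  open import Data.List as List using (filter; length; tabulate)
  import Data.List.Properties as ListP
  open import Data.Product using (_,_; proj₁; proj₂)
  open import Data.Sum using ([_,_]′)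
  open import Data.Bool using (true; false)
  open import Function using (id; _∘_)
  import Algebra.Properties.Semiring.Sum as SemiringSum
  open import Relation.Binary.PropositionalEquality
  open import Relation.Nullary using (Dec; does; ¬_; contradiction)
  open import Relation.Nullary.Decidable using (toSum)
  open import Defs using (IsExponent; IsE; _∈_G)
  open RangeSum
  open DivisorSum using (_∣ᵇ_; gcd-nonZeroʳ; ∣-nonZero)
  open FiniteGroup G
  open Convolution G using (solutions)

  private
    module ℤΣ = SemiringSum ℤP.+-*-semiring

  exponent-∣ : ∀ {ex k} → IsExponent G ex → (∀ h → k · h ≡ 0#) → ex ∣ k
  exponent-∣ {ex} {k} (0<ex , ex·h≡0 , minimal) k·h≡0 = m%n≡0⇒n∣m k ex (remainder≡0 (k % ex) refl)
    where
    instance _ = ℕ.>-nonZero 0<ex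
    remainder-kills : ∀ h → (k % ex) · h ≡ 0#
    remainder-kills h = begin
      (k % ex) · h                          ≡⟨ identityʳ _ ⟨
      (k % ex) · h + 0#                     ≡⟨ cong (_+_ ((k % ex) · h)) (trans (cong ((k / ex) ·_) (ex·h≡0 h)) (·-zeroʳ (k / ex))) ⟨
      (k % ex) · h + (k / ex) · (ex · h)    ≡⟨ cong (_+_ ((k % ex) · h)) (·-assoc (k / ex) ex h) ⟨
      (k % ex) · h + (k / ex ℕ.* ex) · h    ≡⟨ ·-distribʳ-+ (k % ex) (k / ex ℕ.* ex) h ⟨
      (k % ex ℕ.+ k / ex ℕ.* ex) · h        ≡⟨ cong (_· h) (m≡m%n+[m/n]*n k ex) ⟨
      k · h                                 ≡⟨ k·h≡0 h ⟩
      0#                                    ∎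
      where open ≡-Reasoning
    remainder≡0 : ∀ r → k % ex ≡ r → r ≡ 0
    remainder≡0 zero    _  = refl
    remainder≡0 (suc r) eq = contradiction (minimal (suc r) (s≤s z≤n) (λ h → subst (λ x → x · h ≡ 0#) eq (remainder-kills h)))
                                           (ℕP.<⇒≱ (subst (_< ex) eq (m%n<n k ex)))

  exponent∣order : ∀ {ex} → IsExponent G ex → ex ∣ n
  exponent∣order isEx = exponent-∣ isEx lagrange

  private
    lcm≡ : ∀ m n a b k .{{_ : NonZero (gcd m n)}} → a ℕ.* gcd m n ≡ b → b ℕ.* k ≡ m ℕ.* n → lcm m n ≡ a ℕ.* k
    lcm≡ m n a b k a*c≡b b*k≡m*n = ℕP.*-cancelˡ-≡ (lcm m n) (a ℕ.* k) (gcd m n) (begin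
      gcd m n ℕ.* lcm m n      ≡⟨ gcd*lcm m n ⟩
      m ℕ.* n                  ≡⟨ b*k≡m*n ⟨
      b ℕ.* k                  ≡⟨ cong (ℕ._* k) a*c≡b ⟨
      a ℕ.* gcd m n ℕ.* k      ≡⟨ swap a (gcd m n) k ⟩
      gcd m n ℕ.* (a ℕ.* k)    ∎)
      where
      open ≡-Reasoning
      swap : ∀ a c k → a ℕ.* c ℕ.* k ≡ c ℕ.* (a ℕ.* k)
      swap = solve-∀

  lcm≡[m/gcd]*n : ∀ m n .{{_ : NonZero (gcd m n)}} → lcm m n ≡ (m / gcd m n) ℕ.* n
  lcm≡[m/gcd]*n m n = lcm≡ m n (m / gcd m n) m n (m/n*n≡m (gcd[m,n]∣m m n)) refl

  lcm≡[n/gcd]*m : ∀ m n .{{_ : NonZero (gcd m n)}} → lcm m n ≡ (n / gcd m n) ℕ.* m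
  lcm≡[n/gcd]*m m n = lcm≡ m n (n / gcd m n) n m (m/n*n≡m (gcd[m,n]∣n m n)) (ℕP.*-comm n m)

  ∈-lcm : ∀ {g d e} .{{_ : NonZero e}} → _∈_G G g d → _∈_G G g e → _∈_G G g (lcm d e)
  ∈-lcm {g} {d} {e} (a , d·a≡g) (b , e·b≡g) = fromBézout (coprime-Bézout (coprime-/gcd d e))
    where
    instance _ = gcd-nonZeroʳ d e
    c = gcd d e
    d′ = d / c
    e′ = e / c
    L = lcm d e

    -- L = d′ e = e′ d, so L x b = x d′ (e b) and L y a = y e′ (d a)
    L·multiple : ∀ {m m′ h} → L ≡ m′ ℕ.* m → m · h ≡ g → ∀ x → L · (x · h) ≡ (x ℕ.* m′) · g
    L·multiple {m} {m′} {h} L≡m′m m·h≡g x = begin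
      L · (x · h)                ≡⟨ ·-assoc L x h ⟨
      (L ℕ.* x) · h              ≡⟨ cong (λ k → (k ℕ.* x) · h) L≡m′m ⟩
      (m′ ℕ.* m ℕ.* x) · h       ≡⟨ cong (_· h) (swap m′ m x) ⟩
      (x ℕ.* m′ ℕ.* m) · h       ≡⟨ ·-assoc (x ℕ.* m′) m h ⟩
      (x ℕ.* m′) · (m · h)       ≡⟨ cong ((x ℕ.* m′) ·_) m·h≡g ⟩
      (x ℕ.* m′) · g             ∎
      where
      open ≡-Reasoning
      swap : ∀ m′ m x → m′ ℕ.* m ℕ.* x ≡ x ℕ.* m′ ℕ.* m
      swap = solve-∀

    L·b : ∀ x → L · (x · b) ≡ (x ℕ.* d′) · g
    L·b = L·multiple {e} {d′} (lcm≡[m/gcd]*n d e) e·b≡g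

    L·a : ∀ y → L · (y · a) ≡ (y ℕ.* e′) · g
    L·a = L·multiple {d} {e′} (lcm≡[n/gcd]*m d e) d·a≡g

    combine : ∀ u v {X Y} → X ≡ suc Y → L · u ≡ X · g → L · v ≡ Y · g → L · (u - v) ≡ g
    combine u v refl L·u L·v = trans (·-distribˡ-- L u v) (trans (cong₂ _-_ L·u L·v) (+--cancel g _))

    fromBézout : Bézout.Identity 1 d′ e′ → _∈_G G g L
    fromBézout (Bézout.+- x y 1+ye′≡xd′) = x · b - y · a , combine (x · b) (y · a) (sym 1+ye′≡xd′) (L·b x) (L·a y)
    fromBézout (Bézout.-+ x y 1+xd′≡ye′) = y · a - x · b , combine (y · a) (x · b) (sym 1+xd′≡ye′) (L·a y) (L·b x)

  ∈dG⇒d∣e : ∀ {ex g e d} → IsExponent G ex → IsE G ex g e → d ∣ ex → _∈_G G g d → d ∣ e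
  ∈dG⇒d∣e {ex} {g} {e} {d} (0<ex , _) (e∣ex , g∈eG , maximal) d∣ex g∈dG = subst (d ∣_) L≡e (m∣lcm[m,n] d e)
    where
    instance
      ex≢0 : NonZero ex
      ex≢0 = ℕ.>-nonZero 0<ex
      e≢0 : NonZero e
      e≢0 = ∣-nonZero e∣ex
    L∣ex : lcm d e ∣ ex
    L∣ex = lcm-least d∣ex e∣ex
    L≡e : lcm d e ≡ e
    L≡e = ℕP.≤-antisym (maximal (lcm d e) L∣ex (∈-lcm {d = d} g∈dG g∈eG))
                       (∣⇒≤ {{∣-nonZero L∣ex}} (n∣lcm[m,n] d e))

  +length-filter-tabulate : ∀ {m} {P : Carrier → Set} (P? : ∀ x → Dec (P x)) (f : Fin m → Carrier) →
    + length (filter P? (tabulate f)) ≡ ℤΣ.sum {m} (λ j → 𝟙 (P? (f j)))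
  +length-filter-tabulate {zero}  P? f = refl
  +length-filter-tabulate {suc m} P? f with does (P? (f Fin.zero))
  ... | true  = trans (ℤP.pos-+ 1 _) (cong (ℤ._+_ (+ 1)) (+length-filter-tabulate P? (f ∘ Fin.suc)))
  ... | false = trans (+length-filter-tabulate P? (f ∘ Fin.suc)) (sym (ℤP.+-identityˡ _))

  torsionCount≡solutions : ∀ d → + torsionCount d ≡ solutions d 0#
  torsionCount≡solutions d =
    trans (cong (λ hs → + length (filter (λ h → (d · h) ≟ 0#) hs)) (ListP.map-tabulate id el))
          (+length-filter-tabulate (λ h → (d · h) ≟ 0#) el)

  solutions≡torsionCount : ∀ {ex g e d} → IsExponent G ex → IsE G ex g e → d ∣ ex →
    solutions d g ≡ when (d ∣ᵇ e) (+ torsionCount d)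
  solutions≡torsionCount {ex} {g} {e} {d} isEx isE d∣ex = [ divisor , nonDivisor ]′ (toSum (d ∣? e))
    where
    nonDivisor : ¬ d ∣ e → solutions d g ≡ when (d ∣ᵇ e) (+ torsionCount d)
    nonDivisor d∤e = begin
      solutions d g                ≡⟨ ∑G-cong (λ h → when-no ((d · h) ≟ g) (+ 1)
                                        (λ d·h≡g → d∤e (∈dG⇒d∣e isEx isE d∣ex (h , d·h≡g)))) ⟩
      ∑G (λ _ → + 0)               ≡⟨ ∑G-const (+ 0) ⟩
      + n ℤ.* + 0                  ≡⟨ ℤP.*-zeroʳ (+ n) ⟩
      + 0                          ≡⟨ when-no (d ∣? e) (+ torsionCount d) d∤e ⟨
      when (d ∣ᵇ e) (+ torsionCount d) ∎
      where open ≡-Reasoning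
    divisor : d ∣ e → solutions d g ≡ when (d ∣ᵇ e) (+ torsionCount d)
    divisor (divides q e≡qd) = begin
      solutions d g                            ≡⟨ ∑G-translate h₀ (λ h → 𝟙 ((d · h) ≟ g)) ⟨
      ∑G (λ h → 𝟙 ((d · (h + h₀)) ≟ g))        ≡⟨ ∑G-cong (λ h → when-does-⇔ ((d · (h + h₀)) ≟ g) ((d · h) ≟ 0#) (+ 1)
                                                                          (to h) (from h)) ⟩
      solutions d 0#                           ≡⟨ torsionCount≡solutions d ⟨
      + torsionCount d                         ≡⟨ when-yes (d ∣? e) (+ torsionCount d) (divides q e≡qd) ⟨
      when (d ∣ᵇ e) (+ torsionCount d)         ∎
      where
      open ≡-Reasoning
      b = proj₁ (proj₁ (proj₂ isE))
      h₀ = q · b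
      d·h₀≡g : d · h₀ ≡ g
      d·h₀≡g = trans (sym (·-assoc d q b))
               (trans (cong (_· b) (trans (ℕP.*-comm d q) (sym e≡qd))) (proj₂ (proj₁ (proj₂ isE))))
      to : ∀ h → d · (h + h₀) ≡ g → d · h ≡ 0#
      to h eq = ∙-cancelʳ g (d · h) 0#
        (trans (cong (_+_ (d · h)) (sym d·h₀≡g)) (trans (sym (·-distribˡ-+ d h h₀)) (trans eq (sym (identityˡ g)))))
      from : ∀ h → d · h ≡ 0# → d · (h + h₀) ≡ g
      from h eq = trans (·-distribˡ-+ d h h₀) (trans (cong₂ _+_ eq d·h₀≡g) (identityˡ g))


module Sign where

  open import Data.Nat as ℕ using (ℕ; zero; suc)
  open import Data.Integer as ℤ using (ℤ; +_; -_; _*_; -1ℤ; _^_)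
  import Data.Integer.Properties as ℤP
  open import Relation.Binary.PropositionalEquality

  infix 8 -1^_
  -1^_ : ℕ → ℤ
  -1^ zero  = + 1
  -1^ suc k = - (-1^ k)

  -1^-+ : ∀ a b → -1^ (a ℕ.+ b) ≡ -1^ a * -1^ b
  -1^-+ zero    b = sym (ℤP.*-identityˡ (-1^ b))
  -1^-+ (suc a) b = trans (cong -_ (-1^-+ a b)) (ℤP.neg-distribˡ-* (-1^ a) (-1^ b))

  -1ℤ^≡-1^ : ∀ k → -1ℤ ^ k ≡ -1^ k
  -1ℤ^≡-1^ zero    = refl
  -1ℤ^≡-1^ (suc k) = trans (ℤP.-1*i≡-i _) (cong -_ (-1ℤ^≡-1^ k))


module Newton (G : Defs.FiniteAbelianGroup) where

  open import Data.Nat as ℕ using (ℕ; zero; suc; _<_; _∸_; s≤s; z≤n)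
  import Data.Nat.Properties as ℕP
  open import Data.Integer as ℤ using (ℤ; +_)
  import Data.Integer.Properties as ℤP
  open import Data.Fin as Fin using (Fin)
  open import Data.Fin.Subset using (Subset; ∣_∣)
  open import Data.Vec using (lookup; _∷_)
  open import Data.Bool using (true; false; if_then_else_)
  open import Data.List as List using (List; []; _∷_; filter; length)
  import Data.List.Properties as ListP
  open import Data.List.Relation.Unary.All using (universal)
  open import Data.Product using (_×_; _,_)
  open import Data.Sum using (inj₁; inj₂)
  open import Function using (_∘_)
  open import Relation.Unary using (Decidable)
  open import Relation.Binary.PropositionalEquality
  open import Relation.Nullary using (does; yes; no)
  open import Relation.Nullary.Decidable using (_×-dec_)
  import Algebra.Properties.Semiring.Sum as SemiringSum
  open import Data.Integer.Tactic.RingSolver using (solve-∀)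
  open import Defs using (allSubsets)
  open RangeSum
  open Sign
  open FiniteGroup G

  private
    module ℤΣ = SemiringSum ℤP.+-*-semiring

  subfamilySum : ∀ {m} → (Fin m → Carrier) → Subset m → Carrier
  subfamilySum v q = gsum (λ j → if lookup q j then v j else 0#)

  subsetCount : ∀ {m} → (Fin m → Carrier) → ℕ → Carrier → ℤ
  subsetCount {m} v i g = + length (filter (λ q → (∣ q ∣ ℕ.≟ i) ×-dec (subfamilySum v q ≟ g)) (allSubsets m))

  SatisfiesNewton : (ℕ → (Carrier → ℤ) → Carrier → ℤ) → (ℕ → Carrier → ℤ) → Set
  SatisfiesNewton S X = ∀ i g →
    + suc i ℤ.* X (suc i) g ≡ ∑< (suc i) (λ k → -1^ k ℤ.* S (suc k) (X (i ∸ k)) g)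

  length-filter-map : ∀ {A B : Set} {P : B → Set} (P? : Decidable P) (f : A → B) xs →
    length (filter P? (List.map f xs)) ≡ length (filter (P? ∘ f) xs)
  length-filter-map P? f []       = refl
  length-filter-map P? f (x ∷ xs) with does (P? (f x))
  ... | true  = cong suc (length-filter-map P? f xs)
  ... | false = length-filter-map P? f xs

  module _ {m} (v : Fin (suc m) → Carrier) where

    private
      x₀ = v Fin.zero
      w : Fin m → Carrier
      w = v ∘ Fin.suc
      subsets = allSubsets m

    subsetCount-split : ∀ i g → subsetCount v i g ≡
      + length (filter (λ q → (suc ∣ q ∣ ℕ.≟ i) ×-dec ((x₀ + subfamilySum w q) ≟ g)) subsets)
        ℤ.+ subsetCount w i g
    subsetCount-split i g = begin
      + length (filter P? (L₁ List.++ L₀))                  ≡⟨ cong (+_ ∘ length) (ListP.filter-++ P? L₁ L₀) ⟩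
      + length (filter P? L₁ List.++ filter P? L₀)          ≡⟨ cong +_ (ListP.length-++ (filter P? L₁)) ⟩
      + (length (filter P? L₁) ℕ.+ length (filter P? L₀))   ≡⟨ ℤP.pos-+ (length (filter P? L₁)) (length (filter P? L₀)) ⟩
      + length (filter P? L₁) ℤ.+ + length (filter P? L₀)
        ≡⟨ cong₂ ℤ._+_ (cong +_ (length-filter-map P? (true ∷_) subsets))
                       (cong +_ (trans (length-filter-map P? (false ∷_) subsets)
                                       (cong length (ListP.filter-≐ (P? ∘ (false ∷_)) Q? ((λ {q} → drop0 q) , (λ {q} → add0 q)) subsets)))) ⟩
      + length (filter (P? ∘ (true ∷_)) subsets) ℤ.+ subsetCount w i g ∎
      where
      open ≡-Reasoning
      L₁ = List.map (true ∷_) subsets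
      L₀ = List.map (false ∷_) subsets
      P? = λ q → (∣ q ∣ ℕ.≟ i) ×-dec (subfamilySum v q ≟ g)
      Q? = λ q → (∣ q ∣ ℕ.≟ i) ×-dec (subfamilySum w q ≟ g)
      drop0 : ∀ q → (∣ q ∣ ≡ i × 0# + subfamilySum w q ≡ g) → (∣ q ∣ ≡ i × subfamilySum w q ≡ g)
      drop0 _ (size , sum) = size , trans (sym (identityˡ _)) sum
      add0 : ∀ q → (∣ q ∣ ≡ i × subfamilySum w q ≡ g) → (∣ q ∣ ≡ i × 0# + subfamilySum w q ≡ g)
      add0 _ (size , sum) = size , trans (identityˡ _) sum

    subsetCount-zero : ∀ g → subsetCount v 0 g ≡ subsetCount w 0 g
    subsetCount-zero g = trans (subsetCount-split 0 g)
      (trans (cong (λ k → + k ℤ.+ subsetCount w 0 g) (cong length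
               (ListP.filter-none P? (universal (λ q (size , _) → ℕP.1+n≢0 size) subsets))))
             (ℤP.+-identityˡ _))
      where P? = λ q → (suc ∣ q ∣ ℕ.≟ 0) ×-dec ((x₀ + subfamilySum w q) ≟ g)

    subsetCount-suc : ∀ i g → subsetCount v (suc i) g ≡ subsetCount w i (g - x₀) ℤ.+ subsetCount w (suc i) g
    subsetCount-suc i g = trans (subsetCount-split (suc i) g)
      (cong (λ k → + k ℤ.+ subsetCount w (suc i) g) (cong length
        (ListP.filter-≐ P? Q? ((λ {q} → to q) , (λ {q} → from q)) subsets)))
      where
      P? = λ q → (suc ∣ q ∣ ℕ.≟ suc i) ×-dec ((x₀ + subfamilySum w q) ≟ g)
      Q? = λ q → (∣ q ∣ ℕ.≟ i) ×-dec (subfamilySum w q ≟ (g - x₀))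
      to : ∀ q → suc ∣ q ∣ ≡ suc i × x₀ + subfamilySum w q ≡ g → ∣ q ∣ ≡ i × subfamilySum w q ≡ g - x₀
      to q (size , sum) = ℕP.suc-injective size , +≡⇒≡- x₀ (subfamilySum w q) g sum
      from : ∀ q → ∣ q ∣ ≡ i × subfamilySum w q ≡ g - x₀ → suc ∣ q ∣ ≡ suc i × x₀ + subfamilySum w q ≡ g
      from q (size , sum) = cong suc size , ≡-⇒+≡ x₀ (subfamilySum w q) g sum

    withFirst : ℕ → Carrier → ℤ
    withFirst zero    y = + 0
    withFirst (suc l) y = subsetCount w l (y - x₀)

    subsetCount-withFirst : ∀ l y → subsetCount v l y ≡ subsetCount w l y ℤ.+ withFirst l y
    subsetCount-withFirst zero    y = trans (subsetCount-zero y) (sym (ℤP.+-identityʳ _))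
    subsetCount-withFirst (suc l) y = trans (subsetCount-suc l y) (ℤP.+-comm (subsetCount w l (y - x₀)) (subsetCount w (suc l) y))

    shiftSum-subsetCount : ∀ k l y → shiftSum v k (subsetCount v l) y ≡
      shiftSum w k (subsetCount w l) y ℤ.+ shiftSum w k (withFirst l) y ℤ.+ subsetCount v l (y - k · x₀)
    shiftSum-subsetCount k l y = trans (ℤP.+-comm (subsetCount v l (y - k · x₀)) (shiftSum w k (subsetCount v l) y))
      (cong (ℤ._+ subsetCount v l (y - k · x₀))
        (trans (ℤΣ.sum-cong-≗ {m} (λ j → subsetCount-withFirst l (y - k · w j)))
               (ℤΣ.∑-distrib-+ {m} (λ j → subsetCount w l (y - k · w j)) (λ j → withFirst l (y - k · w j)))))

    -- the terms for k and k + 1 cancel in pairs, since (g - (k+1) x₀) - x₀ = g - (k+2) x₀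
    telescope : ∀ i g → ∑< (suc i) (λ k → -1^ k ℤ.* subsetCount v (i ∸ k) (g - suc k · x₀)) ≡ subsetCount w i (g - x₀)
    telescope i g = begin
      ∑< (suc i) (λ k → -1^ k ℤ.* subsetCount v (i ∸ k) (g - suc k · x₀))
        ≡⟨ ∑<-cong (suc i) (λ k → trans (cong (-1^ k ℤ.*_) (subsetCount-withFirst (i ∸ k) (g - suc k · x₀)))
                                        (ℤP.*-distribˡ-+ (-1^ k) (subsetCount w (i ∸ k) (g - suc k · x₀))
                                                               (withFirst (i ∸ k) (g - suc k · x₀)))) ⟩
      ∑< (suc i) (λ k → f k ℤ.+ r k)
        ≡⟨ ∑<-telescope i f r r≡-f r[i]≡0 ⟩
      ℤ.+ 1 ℤ.* subsetCount w i (g - 1 · x₀)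
        ≡⟨ trans (ℤP.*-identityˡ _) (cong (λ x → subsetCount w i (g - x)) (identityʳ x₀)) ⟩
      subsetCount w i (g - x₀) ∎
      where
      open ≡-Reasoning
      f r : ℕ → ℤ
      f k = -1^ k ℤ.* subsetCount w (i ∸ k) (g - suc k · x₀)
      r k = -1^ k ℤ.* withFirst (i ∸ k) (g - suc k · x₀)
      r[i]≡0 : r i ≡ + 0
      r[i]≡0 = trans (cong (λ l → -1^ i ℤ.* withFirst l (g - suc i · x₀)) (ℕP.n∸n≡0 i)) (ℤP.*-zeroʳ (-1^ i))
      r≡-f : ∀ k → k < i → r k ≡ ℤ.- f (suc k)
      r≡-f k k<i = begin
        -1^ k ℤ.* withFirst (i ∸ k) (g - suc k · x₀)
          ≡⟨ cong (λ l → -1^ k ℤ.* withFirst l (g - suc k · x₀)) (ℕP.+-∸-assoc 1 k<i) ⟩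
        -1^ k ℤ.* subsetCount w (i ∸ suc k) (g - suc k · x₀ - x₀)
          ≡⟨ cong (λ y → -1^ k ℤ.* subsetCount w (i ∸ suc k) y) (-‿-+ g x₀ (suc k · x₀)) ⟨
        -1^ k ℤ.* subsetCount w (i ∸ suc k) (g - suc (suc k) · x₀)
          ≡⟨ trans (sym (ℤP.neg-involutive _)) (cong ℤ.-_ (ℤP.neg-distribˡ-* (-1^ k) _)) ⟩
        ℤ.- f (suc k) ∎

    withFirst-newton : SatisfiesNewton (shiftSum w) (subsetCount w) → ∀ i g →
      ∑< (suc i) (λ k → -1^ k ℤ.* shiftSum w (suc k) (withFirst (i ∸ k)) g) ≡ + i ℤ.* subsetCount w i (g - x₀)
    withFirst-newton newton-w zero g =
      trans (ℤP.+-identityʳ _) (trans (ℤP.*-identityˡ _)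
            (trans (ℤΣ.sum-replicate-zero m) (sym (ℤP.*-zeroˡ (subsetCount w 0 (g - x₀))))))
    withFirst-newton newton-w (suc i) g = begin
      ∑< (suc (suc i)) F
        ≡⟨ ∑<-suc (suc i) F ⟩
      ∑< (suc i) F ℤ.+ F (suc i)
        ≡⟨ cong (ℤ._+_ (∑< (suc i) F)) (trans (cong (λ l → -1^ suc i ℤ.* shiftSum w (suc (suc i)) (withFirst l) g) (ℕP.n∸n≡0 (suc i)))
                                                (trans (cong (-1^ suc i ℤ.*_) (ℤΣ.sum-replicate-zero m)) (ℤP.*-zeroʳ (-1^ suc i)))) ⟩
      ∑< (suc i) F ℤ.+ + 0
        ≡⟨ ℤP.+-identityʳ _ ⟩
      ∑< (suc i) F
        ≡⟨ ∑<-cong-< (suc i) (λ k k<i+1 → cong (-1^ k ℤ.*_) (shift k (ℕP.≤-pred k<i+1))) ⟩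
      ∑< (suc i) (λ k → -1^ k ℤ.* shiftSum w (suc k) (subsetCount w (i ∸ k)) (g - x₀))
        ≡⟨ newton-w i (g - x₀) ⟨
      + suc i ℤ.* subsetCount w (suc i) (g - x₀) ∎
      where
      open ≡-Reasoning
      F : ℕ → ℤ
      F k = -1^ k ℤ.* shiftSum w (suc k) (withFirst (suc i ∸ k)) g
      shift : ∀ k → k ℕ.≤ i → shiftSum w (suc k) (withFirst (suc i ∸ k)) g ≡ shiftSum w (suc k) (subsetCount w (i ∸ k)) (g - x₀)
      shift k k≤i rewrite ℕP.+-∸-assoc 1 k≤i =
        ℤΣ.sum-cong-≗ {m} (λ j → cong (subsetCount w (i ∸ k)) (-‿-comm g (suc k · w j) x₀))

  newton : ∀ m (v : Fin m → Carrier) → SatisfiesNewton (shiftSum v) (subsetCount v)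
  newton zero    v i g = trans (ℤP.*-zeroʳ (+ suc i)) (sym (∑<-zero (suc i) _ (λ k _ → ℤP.*-zeroʳ (-1^ k))))
  newton (suc m) v i g = begin
    + suc i ℤ.* subsetCount v (suc i) g
      ≡⟨ cong (+ suc i ℤ.*_) (subsetCount-suc v i g) ⟩
    + suc i ℤ.* (E′ i (g - x₀) ℤ.+ E′ (suc i) g)
      ≡⟨ expand (+ i) (E′ i (g - x₀)) (E′ (suc i) g) ⟩
    + suc i ℤ.* E′ (suc i) g ℤ.+ (+ i ℤ.* E′ i (g - x₀) ℤ.+ E′ i (g - x₀))
      ≡⟨ cong₂ ℤ._+_ (newton m w i g) (cong₂ ℤ._+_ (sym (withFirst-newton v (newton m w) i g)) (sym (telescope v i g))) ⟩
    ∑< (suc i) T₁ ℤ.+ (∑< (suc i) T₂ ℤ.+ ∑< (suc i) T₃)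
      ≡⟨ cong (ℤ._+_ (∑< (suc i) T₁)) (∑<-distrib-+ (suc i) T₂ T₃) ⟨
    ∑< (suc i) T₁ ℤ.+ ∑< (suc i) (λ k → T₂ k ℤ.+ T₃ k)
      ≡⟨ ∑<-distrib-+ (suc i) T₁ (λ k → T₂ k ℤ.+ T₃ k) ⟨
    ∑< (suc i) (λ k → T₁ k ℤ.+ (T₂ k ℤ.+ T₃ k))
      ≡⟨ ∑<-cong (suc i) (λ k → trans (distrib (-1^ k) (shiftSum w (suc k) (E′ (i ∸ k)) g)
                                                       (shiftSum w (suc k) (withFirst v (i ∸ k)) g)
                                                       (subsetCount v (i ∸ k) (g - suc k · x₀)))
                                      (cong (-1^ k ℤ.*_) (sym (shiftSum-subsetCount v (suc k) (i ∸ k) g)))) ⟩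
    ∑< (suc i) (λ k → -1^ k ℤ.* shiftSum v (suc k) (subsetCount v (i ∸ k)) g) ∎
    where
    open ≡-Reasoning
    x₀ = v Fin.zero
    w = v ∘ Fin.suc
    E′ = subsetCount w
    T₁ T₂ T₃ : ℕ → ℤ
    T₁ k = -1^ k ℤ.* shiftSum w (suc k) (E′ (i ∸ k)) g
    T₂ k = -1^ k ℤ.* shiftSum w (suc k) (withFirst v (i ∸ k)) g
    T₃ k = -1^ k ℤ.* subsetCount v (i ∸ k) (g - suc k · x₀)
    expand : ∀ i a b → (+ 1 ℤ.+ i) ℤ.* (a ℤ.+ b) ≡ (+ 1 ℤ.+ i) ℤ.* b ℤ.+ (i ℤ.* a ℤ.+ a)
    expand = solve-∀
    distrib : ∀ s a b c → s ℤ.* a ℤ.+ (s ℤ.* b ℤ.+ s ℤ.* c) ≡ s ℤ.* (a ℤ.+ b ℤ.+ c)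
    distrib = solve-∀

  subsetCount-empty : ∀ {m} (v : Fin m → Carrier) g → subsetCount v 0 g ≡ 𝟙 (0# ≟ g)
  subsetCount-empty {zero}  v g with 0# ≟ g
  ... | yes _ = refl
  ... | no  _ = refl
  subsetCount-empty {suc m} v g = trans (subsetCount-zero v g) (subsetCount-empty (v ∘ Fin.suc) g)

  newton-unique : ∀ (S : ℕ → (Carrier → ℤ) → Carrier → ℤ) {X Y : ℕ → Carrier → ℤ} →
    (∀ k {f f′} → (∀ y → f y ≡ f′ y) → ∀ g → S k f g ≡ S k f′ g) →
    SatisfiesNewton S X → SatisfiesNewton S Y → (∀ g → X 0 g ≡ Y 0 g) → ∀ l g → X l g ≡ Y l g
  newton-unique S {X} {Y} S-cong newton-X newton-Y X₀≡Y₀ l = agree l l ℕP.≤-refl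
    where
    agree : ∀ i l → l ℕ.≤ i → ∀ g → X l g ≡ Y l g
    agree zero    zero z≤n g = X₀≡Y₀ g
    agree (suc i) l l≤i+1 g with ℕP.m≤n⇒m<n∨m≡n l≤i+1
    ... | inj₁ (s≤s l≤i) = agree i l l≤i g
    ... | inj₂ refl      = ℤP.*-cancelˡ-≡ (+ suc i) (X (suc i) g) (Y (suc i) g) (begin
      + suc i ℤ.* X (suc i) g                                    ≡⟨ newton-X i g ⟩
      ∑< (suc i) (λ k → -1^ k ℤ.* S (suc k) (X (i ∸ k)) g)       ≡⟨ ∑<-cong (suc i) (λ k → cong (-1^ k ℤ.*_)
                                                                       (S-cong (suc k) (agree i (i ∸ k) (ℕP.m∸n≤m i k)) g)) ⟩
      ∑< (suc i) (λ k → -1^ k ℤ.* S (suc k) (Y (i ∸ k)) g)       ≡⟨ newton-Y i g ⟨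
      + suc i ℤ.* Y (suc i) g                                    ∎)
      where open ≡-Reasoning


module Binomial where

  open import Data.Nat as ℕ using (ℕ; zero; suc; _≤_; _<_; _∸_)
  import Data.Nat.Properties as ℕP
  open import Data.Nat.Combinatorics using (_C_; nCk+nC[k+1]≡[n+1]C[k+1]; nC1≡n)
  open import Data.Nat.Divisibility
  import Data.Nat.Tactic.RingSolver as ℕSolver
  open import Data.Integer as ℤ using (ℤ; +_; -1ℤ; _^_)
  import Data.Integer.Properties as ℤP
  open import Data.Integer.Tactic.RingSolver using (solve-∀)
  open import Data.Sum using ([_,_]′)
  open import Relation.Binary.PropositionalEquality
  open import Relation.Nullary using (¬_)
  open import Relation.Nullary.Decidable using (toSum)
  open import Defs using (_div_)
  open RangeSum
  open DivisorSum using (_∣ᵇ_; ∑<-multiples; m*n-div-m≡n)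
  open Sign

  [1+k]*nC[1+k]+k*nCk≡n*nCk : ∀ n k → suc k ℕ.* (n C suc k) ℕ.+ k ℕ.* (n C k) ≡ n ℕ.* (n C k)
  [1+k]*nC[1+k]+k*nCk≡n*nCk zero    zero    = refl
  [1+k]*nC[1+k]+k*nCk≡n*nCk zero    (suc k) = cong₂ ℕ._+_ (ℕP.*-zeroʳ (suc (suc k))) (ℕP.*-zeroʳ (suc k))
  [1+k]*nC[1+k]+k*nCk≡n*nCk (suc n) zero    =
    trans (ℕP.+-identityʳ _) (trans (ℕP.*-identityˡ _) (trans (nC1≡n (suc n)) (sym (ℕP.*-identityʳ (suc n)))))
  [1+k]*nC[1+k]+k*nCk≡n*nCk (suc n) (suc k) = begin
    suc (suc k) ℕ.* (suc n C suc (suc k)) ℕ.+ suc k ℕ.* (suc n C suc k)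
      ≡⟨ cong₂ (λ a b → suc (suc k) ℕ.* a ℕ.+ suc k ℕ.* b)
               (nCk+nC[k+1]≡[n+1]C[k+1] n (suc k)) (nCk+nC[k+1]≡[n+1]C[k+1] n k) ⟨
    suc (suc k) ℕ.* (c₁ ℕ.+ c₂) ℕ.+ suc k ℕ.* (c₀ ℕ.+ c₁)
      ≡⟨ regroup₁ k c₀ c₁ c₂ ⟩
    suc (suc k) ℕ.* c₁ ℕ.+ (suc (suc k) ℕ.* c₂ ℕ.+ suc k ℕ.* c₁) ℕ.+ suc k ℕ.* c₀
      ≡⟨ cong (λ z → suc (suc k) ℕ.* c₁ ℕ.+ z ℕ.+ suc k ℕ.* c₀) ([1+k]*nC[1+k]+k*nCk≡n*nCk n (suc k)) ⟩
    suc (suc k) ℕ.* c₁ ℕ.+ n ℕ.* c₁ ℕ.+ suc k ℕ.* c₀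
      ≡⟨ regroup₂ k n c₀ c₁ ⟩
    (suc k ℕ.* c₁ ℕ.+ k ℕ.* c₀) ℕ.+ n ℕ.* c₁ ℕ.+ c₀ ℕ.+ c₁
      ≡⟨ cong (λ z → z ℕ.+ n ℕ.* c₁ ℕ.+ c₀ ℕ.+ c₁) ([1+k]*nC[1+k]+k*nCk≡n*nCk n k) ⟩
    n ℕ.* c₀ ℕ.+ n ℕ.* c₁ ℕ.+ c₀ ℕ.+ c₁
      ≡⟨ regroup₃ n c₀ c₁ ⟩
    suc n ℕ.* (c₀ ℕ.+ c₁)
      ≡⟨ cong (suc n ℕ.*_) (nCk+nC[k+1]≡[n+1]C[k+1] n k) ⟩
    suc n ℕ.* (suc n C suc k) ∎
    where
    open ≡-Reasoning
    c₀ = n C k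
    c₁ = n C suc k
    c₂ = n C suc (suc k)
    regroup₁ : ∀ k c₀ c₁ c₂ → suc (suc k) ℕ.* (c₁ ℕ.+ c₂) ℕ.+ suc k ℕ.* (c₀ ℕ.+ c₁)
                            ≡ suc (suc k) ℕ.* c₁ ℕ.+ (suc (suc k) ℕ.* c₂ ℕ.+ suc k ℕ.* c₁) ℕ.+ suc k ℕ.* c₀
    regroup₁ = ℕSolver.solve-∀
    regroup₂ : ∀ k n c₀ c₁ → suc (suc k) ℕ.* c₁ ℕ.+ n ℕ.* c₁ ℕ.+ suc k ℕ.* c₀
                           ≡ (suc k ℕ.* c₁ ℕ.+ k ℕ.* c₀) ℕ.+ n ℕ.* c₁ ℕ.+ c₀ ℕ.+ c₁
    regroup₂ = ℕSolver.solve-∀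
    regroup₃ : ∀ n c₀ c₁ → n ℕ.* c₀ ℕ.+ n ℕ.* c₁ ℕ.+ c₀ ℕ.+ c₁ ≡ suc n ℕ.* (c₀ ℕ.+ c₁)
    regroup₃ = ℕSolver.solve-∀

  *-alternating-∑C : ∀ n k → + n ℤ.* ∑< k (λ r → -1^ r ℤ.* + (n C r)) ≡ + k ℤ.* -1^ suc k ℤ.* + (n C k)
  *-alternating-∑C n zero    = ℤP.*-zeroʳ (+ n)
  *-alternating-∑C n (suc k) = begin
    + n ℤ.* ∑< (suc k) f                                           ≡⟨ cong (+ n ℤ.*_) (∑<-suc k f) ⟩
    + n ℤ.* (∑< k f ℤ.+ f k)                                       ≡⟨ ℤP.*-distribˡ-+ (+ n) (∑< k f) (f k) ⟩
    + n ℤ.* ∑< k f ℤ.+ + n ℤ.* f k                                 ≡⟨ cong (ℤ._+ + n ℤ.* f k) (*-alternating-∑C n k) ⟩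
    + k ℤ.* -1^ suc k ℤ.* + (n C k) ℤ.+ + n ℤ.* (-1^ k ℤ.* + (n C k)) ≡⟨ regroup (+ k) (-1^ k) (+ n) (+ (n C k)) ⟩
    -1^ k ℤ.* (+ n ℤ.* + (n C k) ℤ.- + k ℤ.* + (n C k))             ≡⟨ cong (-1^ k ℤ.*_) pascal ⟩
    -1^ k ℤ.* (+ suc k ℤ.* + (n C suc k))                           ≡⟨ regroup′ (-1^ k) (+ suc k) (+ (n C suc k)) ⟩
    + suc k ℤ.* -1^ suc (suc k) ℤ.* + (n C suc k)                   ∎
    where
    open ≡-Reasoning
    f : ℕ → ℤ
    f r = -1^ r ℤ.* + (n C r)
    regroup : ∀ k s n c → k ℤ.* (ℤ.- s) ℤ.* c ℤ.+ n ℤ.* (s ℤ.* c) ≡ s ℤ.* (n ℤ.* c ℤ.- k ℤ.* c)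
    regroup = solve-∀
    regroup′ : ∀ s k c → s ℤ.* (k ℤ.* c) ≡ k ℤ.* (ℤ.- (ℤ.- s)) ℤ.* c
    regroup′ = solve-∀
    cancel : ∀ a b → a ℤ.+ b ℤ.- b ≡ a
    cancel = solve-∀
    pascal : + n ℤ.* + (n C k) ℤ.- + k ℤ.* + (n C k) ≡ + suc k ℤ.* + (n C suc k)
    pascal = begin
      + n ℤ.* + (n C k) ℤ.- + k ℤ.* + (n C k)
        ≡⟨ cong₂ ℤ._-_ (ℤP.pos-* n (n C k)) (ℤP.pos-* k (n C k)) ⟨
      + (n ℕ.* (n C k)) ℤ.- + (k ℕ.* (n C k))
        ≡⟨ cong (λ z → + z ℤ.- + (k ℕ.* (n C k))) ([1+k]*nC[1+k]+k*nCk≡n*nCk n k) ⟨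
      + (suc k ℕ.* (n C suc k) ℕ.+ k ℕ.* (n C k)) ℤ.- + (k ℕ.* (n C k))
        ≡⟨ cong (ℤ._- + (k ℕ.* (n C k))) (ℤP.pos-+ (suc k ℕ.* (n C suc k)) (k ℕ.* (n C k))) ⟩
      + (suc k ℕ.* (n C suc k)) ℤ.+ + (k ℕ.* (n C k)) ℤ.- + (k ℕ.* (n C k))
        ≡⟨ cancel (+ (suc k ℕ.* (n C suc k))) (+ (k ℕ.* (n C k))) ⟩
      + (suc k ℕ.* (n C suc k))
        ≡⟨ ℤP.pos-* (suc k) (n C suc k) ⟩
      + suc k ℤ.* + (n C suc k) ∎

  coeff : ℕ → ℕ → ℕ → ℤ
  coeff N s l = when (s ∣ᵇ l) (-1ℤ ^ (l ℕ.+ l div s) ℤ.* + ((N div s) C (l div s)))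

  coeff-zero : ∀ N s .{{_ : ℕ.NonZero s}} → coeff N s 0 ≡ + 1
  coeff-zero N (suc _) = refl

  coeff-multiple : ∀ s m r .{{_ : ℕ.NonZero s}} → coeff (s ℕ.* m) s (s ℕ.* r) ≡ -1^ (s ℕ.* r) ℤ.* (-1^ r ℤ.* + (m C r))
  coeff-multiple s m r = begin
    coeff (s ℕ.* m) s (s ℕ.* r)
      ≡⟨ when-yes (s ∣? s ℕ.* r) _ (m∣m*n r) ⟩
    -1ℤ ^ (s ℕ.* r ℕ.+ (s ℕ.* r) div s) ℤ.* + (((s ℕ.* m) div s) C ((s ℕ.* r) div s))
      ≡⟨ cong₂ (λ a b → -1ℤ ^ (s ℕ.* r ℕ.+ a) ℤ.* + (b C a)) (m*n-div-m≡n s r) (m*n-div-m≡n s m) ⟩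
    -1ℤ ^ (s ℕ.* r ℕ.+ r) ℤ.* + (m C r)
      ≡⟨ cong (ℤ._* + (m C r)) (trans (-1ℤ^≡-1^ (s ℕ.* r ℕ.+ r)) (-1^-+ (s ℕ.* r) r)) ⟩
    -1^ (s ℕ.* r) ℤ.* -1^ r ℤ.* + (m C r)
      ≡⟨ ℤP.*-assoc (-1^ (s ℕ.* r)) (-1^ r) (+ (m C r)) ⟩
    -1^ (s ℕ.* r) ℤ.* (-1^ r ℤ.* + (m C r)) ∎
    where open ≡-Reasoning

  coeffNewtonSum : ℕ → ℕ → ℕ → ℤ
  coeffNewtonSum N s i = ∑< (suc i) (λ k → -1^ k ℤ.* (+ N ℤ.* when (s ∣ᵇ suc k) (coeff N s (i ∸ k))))

  coeffNewtonSum-∤ : ∀ N s i → ¬ s ∣ suc i → coeffNewtonSum N s i ≡ + suc i ℤ.* coeff N s (suc i)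
  coeffNewtonSum-∤ N s i s∤i+1 =
    trans (∑<-zero (suc i) _ (λ k k<i+1 → term≡0 k (ℕP.≤-pred k<i+1)))
          (sym (trans (cong (+ suc i ℤ.*_) (when-no (s ∣? suc i) _ s∤i+1)) (ℤP.*-zeroʳ (+ suc i))))
    where
    not-both : ∀ k → k ≤ i → s ∣ suc k → ¬ s ∣ i ∸ k
    not-both k k≤i s∣k+1 s∣i-k =
      s∤i+1 (subst (s ∣_) (cong suc (ℕP.m+[n∸m]≡n k≤i)) (∣m∣n⇒∣m+n s∣k+1 s∣i-k))
    term≡0 : ∀ k → k ≤ i → -1^ k ℤ.* (+ N ℤ.* when (s ∣ᵇ suc k) (coeff N s (i ∸ k))) ≡ + 0
    term≡0 k k≤i = begin
      -1^ k ℤ.* (+ N ℤ.* when (s ∣ᵇ suc k) (coeff N s (i ∸ k)))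
        ≡⟨ cong (λ z → -1^ k ℤ.* (+ N ℤ.* z))
             (when-does-cong (s ∣? suc k) (λ s∣k+1 → when-no (s ∣? i ∸ k) _ (not-both k k≤i s∣k+1))) ⟩
      -1^ k ℤ.* (+ N ℤ.* when (s ∣ᵇ suc k) (+ 0))
        ≡⟨ cong (λ z → -1^ k ℤ.* (+ N ℤ.* z)) (when-zero (s ∣ᵇ suc k)) ⟩
      -1^ k ℤ.* (+ N ℤ.* + 0)
        ≡⟨ trans (cong (-1^ k ℤ.*_) (ℤP.*-zeroʳ (+ N))) (ℤP.*-zeroʳ (-1^ k)) ⟩
      + 0 ∎
      where open ≡-Reasoning

  -- the summand for k + 1 = s (u + 1): then i - k = s r with r = J - (u + 1)
  coeffNewtonSum-term : ∀ s m i J .{{_ : ℕ.NonZero s}} → suc i ≡ s ℕ.* J → ∀ u → u < J →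
    -1^ (s ℕ.* suc u ∸ 1) ℤ.* (+ (s ℕ.* m) ℤ.* coeff (s ℕ.* m) s (suc i ∸ s ℕ.* suc u))
      ≡ -1^ i ℤ.* (+ (s ℕ.* m) ℤ.* (-1^ (J ∸ suc u) ℤ.* + (m C (J ∸ suc u))))
  coeffNewtonSum-term s@(suc s′) m i J i+1≡sJ u u<J = begin
    -1^ K ℤ.* (+ N ℤ.* coeff N s (suc i ∸ suc K))    ≡⟨ cong (λ z → -1^ K ℤ.* (+ N ℤ.* coeff N s z)) rest ⟩
    -1^ K ℤ.* (+ N ℤ.* coeff N s (s ℕ.* r))          ≡⟨ cong (λ z → -1^ K ℤ.* (+ N ℤ.* z)) (coeff-multiple s m r) ⟩
    -1^ K ℤ.* (+ N ℤ.* (-1^ (s ℕ.* r) ℤ.* g))        ≡⟨ regroup (-1^ K) (+ N) (-1^ (s ℕ.* r)) g ⟩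
    (-1^ K ℤ.* -1^ (s ℕ.* r)) ℤ.* (+ N ℤ.* g)        ≡⟨ cong (ℤ._* (+ N ℤ.* g)) (trans (cong -1^_ i≡K+sr) (-1^-+ K (s ℕ.* r))) ⟨
    -1^ i ℤ.* (+ N ℤ.* g)                            ∎
    where
    open ≡-Reasoning
    N = s ℕ.* m
    r = J ∸ suc u
    g = -1^ r ℤ.* + (m C r)
    K = u ℕ.+ s′ ℕ.* suc u
    i+1≡K+1+sr : suc i ≡ suc K ℕ.+ s ℕ.* r
    i+1≡K+1+sr = trans i+1≡sJ (trans (cong (s ℕ.*_) (sym (ℕP.m+[n∸m]≡n u<J))) (ℕP.*-distribˡ-+ s (suc u) r))
    i≡K+sr : i ≡ K ℕ.+ s ℕ.* r
    i≡K+sr = ℕP.suc-injective i+1≡K+1+sr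
    rest : suc i ∸ suc K ≡ s ℕ.* r
    rest = trans (cong (_∸ suc K) i+1≡K+1+sr) (ℕP.m+n∸m≡n (suc K) (s ℕ.* r))
    regroup : ∀ a n b c → a ℤ.* (n ℤ.* (b ℤ.* c)) ≡ (a ℤ.* b) ℤ.* (n ℤ.* c)
    regroup = solve-∀

  coeffNewtonSum-∣ : ∀ s m i J .{{_ : ℕ.NonZero s}} → suc i ≡ s ℕ.* J →
    coeffNewtonSum (s ℕ.* m) s i ≡ + suc i ℤ.* coeff (s ℕ.* m) s (suc i)
  coeffNewtonSum-∣ s@(suc s′) m i J i+1≡sJ = begin
    ∑< (suc i) (λ k → -1^ k ℤ.* (+ N ℤ.* when (s ∣ᵇ suc k) (coeff N s (i ∸ k))))
      ≡⟨ ∑<-cong (suc i) pull ⟩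
    ∑< (suc i) (λ k → when (s ∣ᵇ suc k) (f (suc k)))
      ≡⟨ cong (λ x → ∑< x (λ k → when (s ∣ᵇ suc k) (f (suc k)))) i+1≡sJ ⟩
    ∑< (s ℕ.* J) (λ k → when (s ∣ᵇ suc k) (f (suc k)))
      ≡⟨ ∑<-multiples s′ J f ⟩
    ∑< J (λ u → f (s ℕ.* suc u))
      ≡⟨ ∑<-cong-< J (coeffNewtonSum-term s m i J i+1≡sJ) ⟩
    ∑< J (λ u → -1^ i ℤ.* (+ N ℤ.* g (J ∸ suc u)))
      ≡⟨ trans (cong (-1^ i ℤ.*_) (*-distribˡ-∑< J (+ N) (λ u → g (J ∸ suc u))))
               (*-distribˡ-∑< J (-1^ i) (λ u → + N ℤ.* g (J ∸ suc u))) ⟨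
    -1^ i ℤ.* (+ N ℤ.* ∑< J (λ u → g (J ∸ suc u)))
      ≡⟨ cong (λ z → -1^ i ℤ.* (+ N ℤ.* z)) (∑<-reverse J g) ⟨
    -1^ i ℤ.* (+ N ℤ.* ∑< J g)
      ≡⟨ cong (λ z → -1^ i ℤ.* (z ℤ.* ∑< J g)) (ℤP.pos-* s m) ⟩
    -1^ i ℤ.* (+ s ℤ.* + m ℤ.* ∑< J g)
      ≡⟨ cong (-1^ i ℤ.*_) (ℤP.*-assoc (+ s) (+ m) (∑< J g)) ⟩
    -1^ i ℤ.* (+ s ℤ.* (+ m ℤ.* ∑< J g))
      ≡⟨ cong (λ z → -1^ i ℤ.* (+ s ℤ.* z)) (*-alternating-∑C m J) ⟩
    -1^ i ℤ.* (+ s ℤ.* (+ J ℤ.* -1^ suc J ℤ.* + (m C J)))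
      ≡⟨ regroup (-1^ i) (+ s) (+ J) (-1^ J) (+ (m C J)) ⟩
    + s ℤ.* + J ℤ.* (-1^ suc i ℤ.* (-1^ J ℤ.* + (m C J)))
      ≡⟨ cong (ℤ._* (-1^ suc i ℤ.* (-1^ J ℤ.* + (m C J)))) (ℤP.pos-* s J) ⟨
    + (s ℕ.* J) ℤ.* (-1^ suc i ℤ.* (-1^ J ℤ.* + (m C J)))
      ≡⟨ cong (λ a → + a ℤ.* (-1^ suc i ℤ.* (-1^ J ℤ.* + (m C J)))) i+1≡sJ ⟨
    + suc i ℤ.* (-1^ suc i ℤ.* (-1^ J ℤ.* + (m C J)))
      ≡⟨ cong (λ b → + suc i ℤ.* (-1^ b ℤ.* (-1^ J ℤ.* + (m C J)))) i+1≡sJ ⟩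
    + suc i ℤ.* (-1^ (s ℕ.* J) ℤ.* (-1^ J ℤ.* + (m C J)))
      ≡⟨ cong (+ suc i ℤ.*_) (trans (cong (coeff N s) i+1≡sJ) (coeff-multiple s m J)) ⟨
    + suc i ℤ.* coeff N s (suc i) ∎
    where
    open ≡-Reasoning
    N = s ℕ.* m
    f : ℕ → ℤ
    f K = -1^ (K ∸ 1) ℤ.* (+ N ℤ.* coeff N s (suc i ∸ K))
    g : ℕ → ℤ
    g r = -1^ r ℤ.* + (m C r)
    pull : ∀ k → -1^ k ℤ.* (+ N ℤ.* when (s ∣ᵇ suc k) (coeff N s (i ∸ k))) ≡ when (s ∣ᵇ suc k) (f (suc k))
    pull k = trans (cong (-1^ k ℤ.*_) (when-*ʳ (s ∣ᵇ suc k) (+ N) (coeff N s (i ∸ k))))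
                   (when-*ʳ (s ∣ᵇ suc k) (-1^ k) (+ N ℤ.* coeff N s (i ∸ k)))
    regroup : ∀ a s j b c → a ℤ.* (s ℤ.* (j ℤ.* (ℤ.- b) ℤ.* c)) ≡ (s ℤ.* j) ℤ.* (ℤ.- a ℤ.* (b ℤ.* c))
    regroup = solve-∀

  coeff-newton : ∀ s m i .{{_ : ℕ.NonZero s}} → coeffNewtonSum (s ℕ.* m) s i ≡ + suc i ℤ.* coeff (s ℕ.* m) s (suc i)
  coeff-newton s m i = [ divisible , coeffNewtonSum-∤ (s ℕ.* m) s i ]′ (toSum (s ∣? suc i))
    where
    divisible : s ∣ suc i → coeffNewtonSum (s ℕ.* m) s i ≡ + suc i ℤ.* coeff (s ℕ.* m) s (suc i)
    divisible (divides J i+1≡Js) = coeffNewtonSum-∣ s m i J (trans i+1≡Js (ℕP.*-comm J s))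

module SubsetSumFormula (G : Defs.FiniteAbelianGroup) where

  open import Data.Nat as ℕ using (ℕ; suc; _∸_; NonZero)
  open import Data.Nat.Divisibility
  open import Data.Nat.GCD using (gcd; gcd-comm)
  open import Data.Nat.Combinatorics using (_C_)
  open import Data.Integer as ℤ using (ℤ; +_; -1ℤ; _^_)
  import Data.Integer.Properties as ℤP
  open import Data.Integer.Tactic.RingSolver using (solve-∀)
  open import Data.Bool using (true; false)
  open import Data.Product using (proj₁; proj₂)
  open import Relation.Binary.PropositionalEquality
  open import Defs using (IsExponent; IsE; sumDiv; μ; _div_)
  open RangeSum
  open DivisorSum
  open Möbius using (möbius-inversion; möbius-inversion′)
  open Sign
  open Binomial using (coeff; coeff-zero; coeffNewtonSum; coeff-newton)
  open FiniteGroup G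
  open Convolution G
  open Torsion G using (exponent∣order; solutions≡torsionCount)
  open Newton G

  ρ : ℕ → Carrier → ℤ
  ρ s g = ∑∣ s (λ d → μ (s div d) ℤ.* solutions d g)

  solutions≡∑∣ρ : ∀ x .{{_ : NonZero x}} g → solutions x g ≡ ∑∣ x (λ r → ρ r g)
  solutions≡∑∣ρ x g = sym (möbius-inversion x (λ d → solutions d g))

  shiftSum-∑∣ : ∀ k M (c : ℕ → ℤ) (F : ℕ → Carrier → ℤ) g →
    shiftSum el k (λ y → ∑∣ M (λ s → c s ℤ.* F s y)) g ≡ ∑∣ M (λ s → c s ℤ.* shiftSum el k (F s) g)
  shiftSum-∑∣ k M c F g = trans (∑G-∑<-comm M (λ h t → when (suc t ∣ᵇ M) (c (suc t) ℤ.* F (suc t) (g - k · h))))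
    (∑<-cong M (λ t → trans (sym (when-∑G (suc t ∣ᵇ M) (λ h → c (suc t) ℤ.* F (suc t) (g - k · h))))
                            (cong (when (suc t ∣ᵇ M)) (sym (*-distribˡ-∑G (c (suc t)) (λ h → F (suc t) (g - k · h)))))))

  shiftSum-ρ : ∀ s .{{_ : NonZero s}} k g → shiftSum el k (ρ s) g ≡ + n ℤ.* when (s ∣ᵇ k) (ρ s g)
  shiftSum-ρ s k g = begin
    shiftSum el k (ρ s) g
      ≡⟨ shiftSum-∑∣ k s (λ d → μ (s div d)) solutions g ⟩
    ∑∣ s (λ d → μ (s div d) ℤ.* shiftSum el k (solutions d) g)
      ≡⟨ ∑∣-cong s (λ d _ → cong (μ (s div d) ℤ.*_) (shiftSum-solutions k d g)) ⟩
    ∑∣ s (λ d → μ (s div d) ℤ.* (+ n ℤ.* solutions (gcd k d) g))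
      ≡⟨ ∑∣-cong s (λ d _ → swap (μ (s div d)) (+ n) (solutions (gcd k d) g)) ⟩
    ∑∣ s (λ d → + n ℤ.* (μ (s div d) ℤ.* solutions (gcd k d) g))
      ≡⟨ *-distribˡ-∑∣ s (+ n) (λ d → μ (s div d) ℤ.* solutions (gcd k d) g) ⟨
    + n ℤ.* ∑∣ s (λ d → μ (s div d) ℤ.* solutions (gcd k d) g)
      ≡⟨ cong (+ n ℤ.*_) (∑∣-cong s (λ d d∣s → cong (μ (s div d) ℤ.*_) (expand d {{∣-nonZero d∣s}}))) ⟩
    + n ℤ.* ∑∣ s (λ d → μ (s div d) ℤ.* ∑∣ d (λ r → when (r ∣ᵇ k) (ρ r g)))
      ≡⟨ cong (+ n ℤ.*_) (möbius-inversion′ s (λ r → when (r ∣ᵇ k) (ρ r g))) ⟩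
    + n ℤ.* when (s ∣ᵇ k) (ρ s g) ∎
    where
    open ≡-Reasoning
    swap : ∀ a b c → a ℤ.* (b ℤ.* c) ≡ b ℤ.* (a ℤ.* c)
    swap = solve-∀
    expand : ∀ d .{{_ : NonZero d}} → solutions (gcd k d) g ≡ ∑∣ d (λ r → when (r ∣ᵇ k) (ρ r g))
    expand d = trans (solutions≡∑∣ρ (gcd k d) {{gcd-nonZeroʳ k d}} g) (∑∣-gcd k d (λ r → ρ r g))

  -- subsetCount el l g is N G l g by definition
  scaledSubsetCount : ℕ → Carrier → ℤ
  scaledSubsetCount l g = + n ℤ.* subsetCount el l g

  scaledSubsetCount-newton : SatisfiesNewton (shiftSum el) scaledSubsetCount
  scaledSubsetCount-newton i g = begin
    + suc i ℤ.* (+ n ℤ.* subsetCount el (suc i) g)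
      ≡⟨ swap (+ suc i) (+ n) (subsetCount el (suc i) g) ⟩
    + n ℤ.* (+ suc i ℤ.* subsetCount el (suc i) g)
      ≡⟨ cong (+ n ℤ.*_) (newton n el i g) ⟩
    + n ℤ.* ∑< (suc i) (λ k → -1^ k ℤ.* shiftSum el (suc k) (subsetCount el (i ∸ k)) g)
      ≡⟨ *-distribˡ-∑< (suc i) (+ n) (λ k → -1^ k ℤ.* shiftSum el (suc k) (subsetCount el (i ∸ k)) g) ⟩
    ∑< (suc i) (λ k → + n ℤ.* (-1^ k ℤ.* shiftSum el (suc k) (subsetCount el (i ∸ k)) g))
      ≡⟨ ∑<-cong (suc i) (λ k → trans (swap (+ n) (-1^ k) _)
           (cong (-1^ k ℤ.*_) (*-distribˡ-∑G (+ n) (λ h → subsetCount el (i ∸ k) (g - suc k · h))))) ⟩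
    ∑< (suc i) (λ k → -1^ k ℤ.* shiftSum el (suc k) (scaledSubsetCount (i ∸ k)) g) ∎
    where
    open ≡-Reasoning
    swap : ∀ a b c → a ℤ.* (b ℤ.* c) ≡ b ℤ.* (a ℤ.* c)
    swap = solve-∀

  module _ {ex} (isEx : IsExponent G ex) where

    instance
      ex≢0 : NonZero ex
      ex≢0 = ℕ.>-nonZero (proj₁ isEx)

    ρ-expansion : ℕ → Carrier → ℤ
    ρ-expansion l g = ∑∣ ex (λ s → coeff n s l ℤ.* ρ s g)

    coeff-newton′ : ∀ s .{{_ : NonZero s}} → s ∣ ex → ∀ i → coeffNewtonSum n s i ≡ + suc i ℤ.* coeff n s (suc i)
    coeff-newton′ s s∣ex i = subst (λ N → coeffNewtonSum N s i ≡ + suc i ℤ.* coeff N s (suc i))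
      (sym (m∣n⇒n≡m*quotient s∣n)) (coeff-newton s (quotient s∣n) i)
      where s∣n = ∣-trans s∣ex (exponent∣order isEx)

    ρ-expansion-newton : SatisfiesNewton (shiftSum el) ρ-expansion
    ρ-expansion-newton i g = sym (begin
      ∑< (suc i) (λ k → -1^ k ℤ.* shiftSum el (suc k) (ρ-expansion (i ∸ k)) g)
        ≡⟨ ∑<-cong (suc i) (λ k → trans (cong (-1^ k ℤ.*_) (expand k)) (*-distribˡ-∑∣ ex (-1^ k) (term k))) ⟩
      ∑< (suc i) (λ k → ∑∣ ex (λ s → -1^ k ℤ.* term k s))
        ≡⟨ ∑<-∑∣-comm (suc i) ex (λ k s → -1^ k ℤ.* term k s) ⟩
      ∑∣ ex (λ s → ∑< (suc i) (λ k → -1^ k ℤ.* term k s))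
        ≡⟨ ∑∣-cong ex (λ s s∣ex → factor s {{∣-nonZero s∣ex}} s∣ex) ⟩
      ∑∣ ex (λ s → + suc i ℤ.* (coeff n s (suc i) ℤ.* ρ s g))
        ≡⟨ *-distribˡ-∑∣ ex (+ suc i) (λ s → coeff n s (suc i) ℤ.* ρ s g) ⟨
      + suc i ℤ.* ρ-expansion (suc i) g ∎)
      where
      open ≡-Reasoning
      term : ℕ → ℕ → ℤ
      term k s = coeff n s (i ∸ k) ℤ.* (+ n ℤ.* when (s ∣ᵇ suc k) (ρ s g))
      expand : ∀ k → shiftSum el (suc k) (ρ-expansion (i ∸ k)) g ≡ ∑∣ ex (term k)
      expand k = trans (shiftSum-∑∣ (suc k) ex (λ s → coeff n s (i ∸ k)) ρ g)
        (∑∣-cong ex (λ s s∣ex → cong (coeff n s (i ∸ k) ℤ.*_) (shiftSum-ρ s {{∣-nonZero s∣ex}} (suc k) g)))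
      regroup : ∀ b σ α N r → σ ℤ.* (α ℤ.* (N ℤ.* when b r)) ≡ (σ ℤ.* (N ℤ.* when b α)) ℤ.* r
      regroup true  = rearrange
        where rearrange : ∀ σ α N r → σ ℤ.* (α ℤ.* (N ℤ.* r)) ≡ (σ ℤ.* (N ℤ.* α)) ℤ.* r
              rearrange = solve-∀
      regroup false = vanish
        where vanish : ∀ σ α N r → σ ℤ.* (α ℤ.* (N ℤ.* + 0)) ≡ (σ ℤ.* (N ℤ.* + 0)) ℤ.* r
              vanish = solve-∀
      factor : ∀ s .{{_ : NonZero s}} → s ∣ ex →
        ∑< (suc i) (λ k → -1^ k ℤ.* term k s) ≡ + suc i ℤ.* (coeff n s (suc i) ℤ.* ρ s g)
      factor s s∣ex = begin
        ∑< (suc i) (λ k → -1^ k ℤ.* term k s)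
          ≡⟨ ∑<-cong (suc i) (λ k → regroup (s ∣ᵇ suc k) (-1^ k) (coeff n s (i ∸ k)) (+ n) (ρ s g)) ⟩
        ∑< (suc i) (λ k → (-1^ k ℤ.* (+ n ℤ.* when (s ∣ᵇ suc k) (coeff n s (i ∸ k)))) ℤ.* ρ s g)
          ≡⟨ *-distribʳ-∑< (suc i) (ρ s g) (λ k → -1^ k ℤ.* (+ n ℤ.* when (s ∣ᵇ suc k) (coeff n s (i ∸ k)))) ⟨
        ∑< (suc i) (λ k → -1^ k ℤ.* (+ n ℤ.* when (s ∣ᵇ suc k) (coeff n s (i ∸ k)))) ℤ.* ρ s g
          ≡⟨ cong (ℤ._* ρ s g) (coeff-newton′ s s∣ex i) ⟩
        + suc i ℤ.* coeff n s (suc i) ℤ.* ρ s g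
          ≡⟨ ℤP.*-assoc (+ suc i) (coeff n s (suc i)) (ρ s g) ⟩
        + suc i ℤ.* (coeff n s (suc i) ℤ.* ρ s g) ∎

    scaledSubsetCount≡ρ-expansion : ∀ l g → scaledSubsetCount l g ≡ ρ-expansion l g
    scaledSubsetCount≡ρ-expansion =
      newton-unique (shiftSum el) (shiftSum-cong el) scaledSubsetCount-newton ρ-expansion-newton base
      where
      base : ∀ g → scaledSubsetCount 0 g ≡ ρ-expansion 0 g
      base g = sym (begin
        ∑∣ ex (λ s → coeff n s 0 ℤ.* ρ s g)
          ≡⟨ ∑∣-cong ex (λ s s∣ex → trans (cong (ℤ._* ρ s g) (coeff-zero n s {{∣-nonZero s∣ex}})) (ℤP.*-identityˡ (ρ s g))) ⟩
        ∑∣ ex (λ s → ρ s g)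
          ≡⟨ solutions≡∑∣ρ ex g ⟨
        solutions ex g
          ≡⟨ ∑G-cong (λ h → cong (λ x → 𝟙 (x ≟ g)) (proj₁ (proj₂ isEx) h)) ⟩
        ∑G (λ _ → 𝟙 (0# ≟ g))
          ≡⟨ ∑G-const (𝟙 (0# ≟ g)) ⟩
        + n ℤ.* 𝟙 (0# ≟ g)
          ≡⟨ cong (+ n ℤ.*_) (subsetCount-empty el g) ⟨
        scaledSubsetCount 0 g ∎)
        where open ≡-Reasoning

    ρ≡torsion : ∀ {g e} → IsE G ex g e → ∀ s .{{_ : NonZero s}} → s ∣ ex →
      ρ s g ≡ sumDiv (gcd e s) (λ d → μ (s div d) ℤ.* + torsionCount d)
    ρ≡torsion {g} {e} isE s s∣ex = begin
      ∑∣ s (λ d → μ (s div d) ℤ.* solutions d g)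
        ≡⟨ ∑∣-cong s (λ d d∣s → trans (cong (μ (s div d) ℤ.*_) (solutions≡torsionCount isEx isE (∣-trans d∣s s∣ex)))
                                      (when-*ʳ (d ∣ᵇ e) (μ (s div d)) (+ torsionCount d))) ⟩
      ∑∣ s (λ d → when (d ∣ᵇ e) (μ (s div d) ℤ.* + torsionCount d))
        ≡⟨ ∑∣-gcd e s (λ d → μ (s div d) ℤ.* + torsionCount d) ⟨
      ∑∣ (gcd e s) (λ d → μ (s div d) ℤ.* + torsionCount d)
        ≡⟨ sumDiv≡∑∣ (gcd e s) (λ d → μ (s div d) ℤ.* + torsionCount d) ⟨
      sumDiv (gcd e s) (λ d → μ (s div d) ℤ.* + torsionCount d) ∎
      where open ≡-Reasoning

    ρ-expansion≡formula : ∀ {g e} → IsE G ex g e → ∀ i →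
      ρ-expansion i g ≡ sumDiv (gcd ex i) (λ s →
        -1ℤ ^ (i ℕ.+ i div s) ℤ.* + ((n div s) C (i div s))
          ℤ.* sumDiv (gcd e s) (λ d → μ (s div d) ℤ.* + torsionCount d))
    ρ-expansion≡formula {g} {e} isE i = sym (begin
      sumDiv (gcd ex i) F                ≡⟨ sumDiv≡∑∣ (gcd ex i) F ⟩
      ∑∣ (gcd ex i) F                    ≡⟨ cong (λ k → ∑∣ k F) (gcd-comm ex i) ⟩
      ∑∣ (gcd i ex) F                    ≡⟨ ∑∣-gcd i ex F ⟩
      ∑∣ ex (λ s → when (s ∣ᵇ i) (F s))  ≡⟨ ∑∣-cong ex (λ s s∣ex → trans
                                              (cong (λ x → when (s ∣ᵇ i) (binomial s ℤ.* x)) (sym (ρ≡torsion isE s {{∣-nonZero s∣ex}} s∣ex)))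
                                              (sym (when-*ˡ (s ∣ᵇ i) (binomial s) (ρ s g)))) ⟩
      ρ-expansion i g                    ∎)
      where
      open ≡-Reasoning
      binomial : ℕ → ℤ
      binomial s = -1ℤ ^ (i ℕ.+ i div s) ℤ.* + ((n div s) C (i div s))
      F : ℕ → ℤ
      F s = binomial s ℤ.* sumDiv (gcd e s) (λ d → μ (s div d) ℤ.* + torsionCount d)


open import Defs
open import Data.Nat using (ℕ; _≤_; _+_)
open import Data.Nat.GCD using (gcd)
open import Data.Nat.Combinatorics using (_C_)
open import Data.Integer as ℤ using (ℤ; +_; -1ℤ; _^_)
open import Relation.Binary.PropositionalEquality using (_≡_; trans)

mainTheorem1 : (G : FiniteAbelianGroup) → (i : ℕ) → i ≤ FiniteAbelianGroup.order G →
    (ex : ℕ) → IsExponent G ex →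
    (g : FiniteAbelianGroup.Carrier G) → (e : ℕ) → IsE G ex g e →
    (+ FiniteAbelianGroup.order G) ℤ.* (+ N G i g)
      ≡ sumDiv (gcd ex i) (λ s →
          (-1ℤ ^ (i + (i div s)))
            ℤ.* (+ ((FiniteAbelianGroup.order G div s) C (i div s)))
            ℤ.* sumDiv (gcd e s) (λ d →
                  μ (s div d) ℤ.* (+ FiniteAbelianGroup.torsionCount G d)))
mainTheorem1 G i _ ex isEx g e isE =
  trans (scaledSubsetCount≡ρ-expansion isEx i g) (ρ-expansion≡formula isEx isE i)
  where open SubsetSumFormula G
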